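{- Let $x$ be an indeterminate and let $m,n$ be positive integers with $m\geq n$. Then, as an identity of rational functions in $x$, \[ \sum_{k=0}^{n} \binom{m+k}{k} \binom{m}{k} \binom{n+k}{k} \binom{n}{k} \Bigl\{ \frac{ -k}{(x+k)^2} + \frac{1+k \bigl(H_{m+k}^{(1)} +H_{m-k}^{(1)} + H_{n+k}^{(1)} + H_{n-k}^{(1)} -4H_k^{(1)}\bigr)}{x+k} \Bigr\} +\sum_{k=n+1}^{m} \frac{(-1)^{k-n}}{x+k} \binom{m+k}{k} \binom{m}{k} \binom{n+k}{k} \Big/ \binom{k-1}{n} =\frac{x\, (1-x)_n\, (1-x)_m}{(x)_{n+1}\, (x)_{m+1}}. \]
   Context: For non-negative integers $i$ and $N$, $H^{(i)}_N:=\sum_{j=1}^{N} j^{ -i}$, with $H^{(i)}_0:=0$. For a quantity $a$ and a non-negative integer $N$, the rising factorial is $(a)_0:=1$ and $(a)_N:=a(a+1)\cdots(a+N-1)$ for $N>0$. The second sum is empty when $m=n$. -}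

module Defs where

open import Data.Nat as ℕ using (ℕ; zero; suc; _∸_)
open import Data.Nat.Combinatorics using (_C_)
open import Data.Integer using (+_)
open import Data.Rational using (ℚ; 0ℚ; 1ℚ; _+_; _*_; -_; _/_; 1/_; _≟_; ≢-nonZero)
open import Relation.Nullary using (yes; no)

⟦_⟧ : ℕ → ℚ
⟦ n ⟧ = + n / 1

-- total inverse: inv p = 1/p for p ≢ 0, and inv 0 = 0 (only used at nonzero arguments)
inv : ℚ → ℚ
inv p with p ≟ 0ℚ
... | yes _ = 0ℚ
... | no p≢0 = 1/_ p {{≢-nonZero p≢0}}

_^_ : ℚ → ℕ → ℚ
p ^ zero = 1ℚ
p ^ suc n = p * (p ^ n)

H : ℕ → ℕ → ℚ
H i zero = 0ℚ
H i (suc N) = H i N + inv (⟦ suc N ⟧ ^ i)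

rising : ℚ → ℕ → ℚ
rising a zero = 1ℚ
rising a (suc N) = rising a N * (a + ⟦ N ⟧)

sumCount : ℕ → ℕ → (ℕ → ℚ) → ℚ
sumCount a zero f = 0ℚ
sumCount a (suc c) f = sumCount a c f + f (a ℕ.+ c)

-- Σ_{k=a}^{b} f k  (empty when b < a)
sumFromTo : ℕ → ℕ → (ℕ → ℚ) → ℚ
sumFromTo a b f = sumCount a (suc b ∸ a) f

binom : ℕ → ℕ → ℚ
binom n k = ⟦ n C k ⟧

sign : ℕ → ℚ
sign zero = 1ℚ
sign (suc k) = - sign k

-- Write R j y = (1 - y)_j / (y)_(j+1) = (1/y) ∏_{1 ≤ i ≤ j} (i - y)/(i + y), so that the right-hand side
-- is y R n y R m y, and note (i - y)/(i + y) = 2i/(y + i) - 1.  Its partial fraction expansion is built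
-- one factor at a time.  Multiplying A/(y+k)² + B/(y+k) by (N - y)/(N + y) and splitting
-- 1/((y+k)(y+N)) rescales the coefficients at the old pole -k by (N+k)/(N-k), which turns
-- (m+k choose k)(m choose k) into its value at m+1 and adds 1/(N+k) + 1/(N-k) to the harmonic sums,
-- and it creates a pole at -N whose coefficient is 2N times the old expansion evaluated at -N, where
-- R j (-N) is an explicit quotient of binomial coefficients.  Along the diagonal m = n the factor
-- enters twice and -N becomes a double pole, whose 1/(y+N) coefficient also needs the derivative
-- at -N; so the expansions are carried along with their formal derivatives, and the logarithmic
-- derivative of R n at -N produces the harmonic numbers.

module Submission where

open import Defs
open import Data.Empty using (⊥-elim)
import Data.Integer as ℤ
import Data.Integer.Properties as ℤ
open import Data.List using ([]; _∷_)
open import Data.Nat as ℕ using (ℕ; zero; suc; _∸_; _≤_; _<_; _≤?_; _≤′_; ≤′-refl; ≤′-step; _!; z≤n; s≤s)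
import Data.Nat.Coprimality as Coprime
open import Data.Nat.Combinatorics using (_C_; nCk≡n!/k![n-k]!; k![n∸k]!∣n!; nCk≡nC[n∸k]; nCn≡1)
import Data.Nat.DivMod as ℕ
import Data.Nat.Properties as ℕ
open import Data.Nat.Tactic.RingSolver using (solve-∀)
open import Data.Product using (_×_; _,_; proj₁; proj₂)
open import Data.Rational using (ℚ; 0ℚ; 1ℚ; _+_; _*_; _-_; -_; mkℚ; _≟_; toℚᵘ; ≢-nonZero; ↥_)
import Data.Rational.Properties as ℚ
import Data.Rational.Unnormalised as ℚᵘ
import Data.Rational.Unnormalised.Properties as ℚᵘ
open import Data.Sum using ([_,_]′)
open import Level using (0ℓ)
open import Relation.Binary.PropositionalEquality
open import Relation.Nullary using (Dec; yes; no; ¬_)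
open import Relation.Nullary.Decidable using (dec⇒maybe; toSum)
open import Tactic.RingSolver using (solve)
open import Tactic.RingSolver.Core.AlmostCommutativeRing using (AlmostCommutativeRing; fromCommutativeRing)

open ≡-Reasoning

ℚ-ring : AlmostCommutativeRing 0ℓ 0ℓ
ℚ-ring = fromCommutativeRing ℚ.+-*-commutativeRing (λ p → dec⇒maybe (0ℚ ≟ p))

⟦⟧≡mkℚ : ∀ n → ⟦ n ⟧ ≡ mkℚ (ℤ.+ n) 0 (Coprime.sym (Coprime.1-coprimeTo n))
⟦⟧≡mkℚ n = ℚ.normalize-coprime (Coprime.sym (Coprime.1-coprimeTo n))

toℚᵘ-⟦⟧ : ∀ n → toℚᵘ ⟦ n ⟧ ≡ ℚᵘ.mkℚᵘ (ℤ.+ n) 0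
toℚᵘ-⟦⟧ n rewrite ⟦⟧≡mkℚ n = refl

⟦⟧-injective : ∀ {a b} → ⟦ a ⟧ ≡ ⟦ b ⟧ → a ≡ b
⟦⟧-injective {a} {b} eq = ℤ.+-injective (cong ↥_ (trans (sym (⟦⟧≡mkℚ a)) (trans eq (⟦⟧≡mkℚ b))))

⟦⟧-homo-+ : ∀ a b → ⟦ a ℕ.+ b ⟧ ≡ ⟦ a ⟧ + ⟦ b ⟧
⟦⟧-homo-+ a b = ℚ.toℚᵘ-injective (ℚᵘ.≃-trans (ℚᵘ.≃-reflexive (toℚᵘ-⟦⟧ (a ℕ.+ b)))
  (ℚᵘ.≃-trans sum (ℚᵘ.≃-sym (ℚ.toℚᵘ-homo-+ ⟦ a ⟧ ⟦ b ⟧))))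
  where
  sum : ℚᵘ.mkℚᵘ (ℤ.+ (a ℕ.+ b)) 0 ℚᵘ.≃ toℚᵘ ⟦ a ⟧ ℚᵘ.+ toℚᵘ ⟦ b ⟧
  sum rewrite toℚᵘ-⟦⟧ a | toℚᵘ-⟦⟧ b = ℚᵘ.*≡* (cong (ℤ._* ℤ.+ 1) (trans (ℤ.pos-+ a b)
    (sym (cong₂ ℤ._+_ (ℤ.*-identityʳ (ℤ.+ a)) (ℤ.*-identityʳ (ℤ.+ b))))))

⟦⟧-homo-+′ : ∀ {N} a b → N ≡ a ℕ.+ b → ⟦ N ⟧ ≡ ⟦ a ⟧ + ⟦ b ⟧
⟦⟧-homo-+′ a b eq = trans (cong ⟦_⟧ eq) (⟦⟧-homo-+ a b)

⟦⟧-homo-* : ∀ a b → ⟦ a ℕ.* b ⟧ ≡ ⟦ a ⟧ * ⟦ b ⟧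
⟦⟧-homo-* a b = ℚ.toℚᵘ-injective (ℚᵘ.≃-trans (ℚᵘ.≃-reflexive (toℚᵘ-⟦⟧ (a ℕ.* b)))
  (ℚᵘ.≃-trans product (ℚᵘ.≃-sym (ℚ.toℚᵘ-homo-* ⟦ a ⟧ ⟦ b ⟧))))
  where
  product : ℚᵘ.mkℚᵘ (ℤ.+ (a ℕ.* b)) 0 ℚᵘ.≃ toℚᵘ ⟦ a ⟧ ℚᵘ.* toℚᵘ ⟦ b ⟧
  product rewrite toℚᵘ-⟦⟧ a | toℚᵘ-⟦⟧ b = ℚᵘ.*≡* (cong (ℤ._* ℤ.+ 1) (ℤ.pos-* a b))

⟦⟧-cast-* : ∀ {x y z w} → x ℕ.* y ≡ z ℕ.* w → ⟦ x ⟧ * ⟦ y ⟧ ≡ ⟦ z ⟧ * ⟦ w ⟧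
⟦⟧-cast-* {x} {y} {z} {w} eq = trans (sym (⟦⟧-homo-* x y)) (trans (cong ⟦_⟧ eq) (⟦⟧-homo-* z w))

⟦suc⟧ : ∀ n → ⟦ suc n ⟧ ≡ 1ℚ + ⟦ n ⟧
⟦suc⟧ n = ⟦⟧-homo-+ 1 n

⟦suc⟧≢0 : ∀ n → ⟦ suc n ⟧ ≢ 0ℚ
⟦suc⟧≢0 n eq with ⟦⟧-injective {suc n} {0} eq
... | ()

⟦⟧-difference : ∀ {N} a b → N ≡ a ℕ.+ b → ⟦ b ⟧ ≡ ⟦ N ⟧ - ⟦ a ⟧
⟦⟧-difference {N} a b eq = begin
  ⟦ b ⟧                  ≡⟨ cancel ⟦ a ⟧ ⟦ b ⟧ ⟩
  ⟦ a ⟧ + ⟦ b ⟧ - ⟦ a ⟧  ≡⟨ cong (_- ⟦ a ⟧) (sym (⟦⟧-homo-+′ a b eq)) ⟩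
  ⟦ N ⟧ - ⟦ a ⟧          ∎
  where
  cancel : ∀ p q → q ≡ p + q - p
  cancel p q = solve (p ∷ q ∷ []) ℚ-ring

⟦∸⟧ : ∀ {a b} → b ≤ a → ⟦ a ∸ b ⟧ ≡ ⟦ a ⟧ - ⟦ b ⟧
⟦∸⟧ {a} {b} b≤a = ⟦⟧-difference b (a ∸ b) (sym (ℕ.m+[n∸m]≡n b≤a))

-⟦N⟧+⟦k⟧≢0 : ∀ {k N} → k < N → - ⟦ N ⟧ + ⟦ k ⟧ ≢ 0ℚ
-⟦N⟧+⟦k⟧≢0 {k} {N} k<N eq = ℕ.<-irrefl (⟦⟧-injective ⟦k⟧≡⟦N⟧) k<N
  where
  ⟦k⟧≡⟦N⟧ : ⟦ k ⟧ ≡ ⟦ N ⟧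
  ⟦k⟧≡⟦N⟧ = begin
    ⟦ k ⟧                    ≡⟨ cancel ⟦ N ⟧ ⟦ k ⟧ ⟩
    (- ⟦ N ⟧ + ⟦ k ⟧) + ⟦ N ⟧ ≡⟨ cong (_+ ⟦ N ⟧) eq ⟩
    0ℚ + ⟦ N ⟧               ≡⟨ ℚ.+-identityˡ ⟦ N ⟧ ⟩
    ⟦ N ⟧                    ∎
    where
    cancel : ∀ p q → q ≡ (- p + q) + p
    cancel p q = solve (p ∷ q ∷ []) ℚ-ring

inv-inverseʳ : ∀ {p} → p ≢ 0ℚ → p * inv p ≡ 1ℚ
inv-inverseʳ {p} p≢0 with p ≟ 0ℚ
... | yes p≡0 = ⊥-elim (p≢0 p≡0)
... | no p≢0′ = ℚ.*-inverseʳ p {{≢-nonZero p≢0′}}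

inv-inverseˡ : ∀ {p} → p ≢ 0ℚ → inv p * p ≡ 1ℚ
inv-inverseˡ {p} p≢0 = trans (ℚ.*-comm (inv p) p) (inv-inverseʳ p≢0)

inv-unique : ∀ {p q} → p * q ≡ 1ℚ → inv p ≡ q
inv-unique {p} {q} pq≡1 = begin
  inv p             ≡⟨ sym (ℚ.*-identityʳ (inv p)) ⟩
  inv p * 1ℚ        ≡⟨ cong (inv p *_) (sym pq≡1) ⟩
  inv p * (p * q)   ≡⟨ sym (ℚ.*-assoc (inv p) p q) ⟩
  (inv p * p) * q   ≡⟨ cong (_* q) (trans (ℚ.*-comm (inv p) p) (inv-inverseʳ p≢0)) ⟩
  1ℚ * q            ≡⟨ ℚ.*-identityˡ q ⟩
  q                 ∎
  where
  p≢0 : p ≢ 0ℚ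
  p≢0 refl = ℚ.1≢0 (trans (sym pq≡1) (ℚ.*-zeroˡ q))

inv-distrib-* : ∀ {p q} → p ≢ 0ℚ → q ≢ 0ℚ → inv (p * q) ≡ inv p * inv q
inv-distrib-* {p} {q} p≢0 q≢0 = inv-unique {p * q} (begin
  p * q * (inv p * inv q)     ≡⟨ interchange p q (inv p) (inv q) ⟩
  (p * inv p) * (q * inv q)   ≡⟨ cong₂ _*_ (inv-inverseʳ p≢0) (inv-inverseʳ q≢0) ⟩
  1ℚ                          ∎)
  where
  interchange : ∀ a b c d → a * b * (c * d) ≡ (a * c) * (b * d)
  interchange a b c d = solve (a ∷ b ∷ c ∷ d ∷ []) ℚ-ring

*-cancelʳ : ∀ {p q r} → r ≢ 0ℚ → p * r ≡ q * r → p ≡ q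
*-cancelʳ {p} {q} {r} r≢0 eq = begin
  p                 ≡⟨ sym (ℚ.*-identityʳ p) ⟩
  p * 1ℚ            ≡⟨ cong (p *_) (sym (inv-inverseʳ r≢0)) ⟩
  p * (r * inv r)   ≡⟨ sym (ℚ.*-assoc p r (inv r)) ⟩
  p * r * inv r     ≡⟨ cong (_* inv r) eq ⟩
  q * r * inv r     ≡⟨ ℚ.*-assoc q r (inv r) ⟩
  q * (r * inv r)   ≡⟨ cong (q *_) (inv-inverseʳ r≢0) ⟩
  q * 1ℚ            ≡⟨ ℚ.*-identityʳ q ⟩
  q                 ∎

*-≢0 : ∀ {p q} → p ≢ 0ℚ → q ≢ 0ℚ → p * q ≢ 0ℚ
*-≢0 {p} {q} p≢0 q≢0 pq≡0 = q≢0 (begin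
  q                 ≡⟨ sym (ℚ.*-identityˡ q) ⟩
  1ℚ * q            ≡⟨ cong (_* q) (sym (inv-inverseˡ p≢0)) ⟩
  inv p * p * q     ≡⟨ ℚ.*-assoc (inv p) p q ⟩
  inv p * (p * q)   ≡⟨ cong (inv p *_) pq≡0 ⟩
  inv p * 0ℚ        ≡⟨ ℚ.*-zeroʳ (inv p) ⟩
  0ℚ                ∎)

reciprocal-sum : ∀ (A B p q : ℚ) → p * (A - B) ≡ 1ℚ → q * (A + B) ≡ 1ℚ → p + q ≡ ⟦ 2 ⟧ * A * (p * q)
reciprocal-sum A B p q hp hq = begin
  p + q                              ≡⟨ solve (p ∷ q ∷ []) ℚ-ring ⟩
  p * 1ℚ + q * 1ℚ                    ≡⟨ cong₂ (λ x z → p * x + q * z) (sym hq) (sym hp) ⟩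
  p * (q * (A + B)) + q * (p * (A - B)) ≡⟨ solve (A ∷ B ∷ p ∷ q ∷ []) ℚ-ring ⟩
  ⟦ 2 ⟧ * A * (p * q)                ∎

reciprocal-difference : ∀ (A B p q : ℚ) → p * (A - B) ≡ 1ℚ → q * (A + B) ≡ 1ℚ → p - q ≡ ⟦ 2 ⟧ * B * (p * q)
reciprocal-difference A B p q hp hq = begin
  p - q                              ≡⟨ solve (p ∷ q ∷ []) ℚ-ring ⟩
  p * 1ℚ - q * 1ℚ                    ≡⟨ cong₂ (λ x z → p * x - q * z) (sym hq) (sym hp) ⟩
  p * (q * (A + B)) - q * (p * (A - B)) ≡⟨ solve (A ∷ B ∷ p ∷ q ∷ []) ℚ-ring ⟩
  ⟦ 2 ⟧ * B * (p * q)                ∎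

reciprocal-neg : ∀ (A B c p : ℚ) → c * (- A + B) ≡ 1ℚ → p * (A - B) ≡ 1ℚ → c ≡ - p
reciprocal-neg A B c p hc hp = begin
  c                               ≡⟨ solve (c ∷ []) ℚ-ring ⟩
  c * 1ℚ                          ≡⟨ cong (c *_) (sym hp) ⟩
  c * (p * (A - B))               ≡⟨ solve (A ∷ B ∷ c ∷ p ∷ []) ℚ-ring ⟩
  - (p * (c * (- A + B)))         ≡⟨ cong (λ w → - (p * w)) hc ⟩
  - (p * 1ℚ)                      ≡⟨ cong -_ (ℚ.*-identityʳ p) ⟩
  - p                             ∎

C-mul-! : ∀ a b → ((a ℕ.+ b) C a) ℕ.* (a ! ℕ.* b !) ≡ (a ℕ.+ b) !
C-mul-! a b = begin
  ((a ℕ.+ b) C a) ℕ.* (a ! ℕ.* b !)              ≡⟨ cong (λ c → ((a ℕ.+ b) C a) ℕ.* (a ! ℕ.* c !)) (sym (ℕ.m+n∸m≡n a b)) ⟩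
  ((a ℕ.+ b) C a) ℕ.* d                          ≡⟨ cong (ℕ._* d) (nCk≡n!/k![n-k]! a≤a+b) ⟩
  ((a ℕ.+ b) ! ℕ./ d) ℕ.* d                      ≡⟨ ℕ.m/n*n≡m (k![n∸k]!∣n! a≤a+b) ⟩
  (a ℕ.+ b) !                                    ∎
  where
  a≤a+b = ℕ.m≤m+n a b
  d = a ! ℕ.* (a ℕ.+ b ∸ a) !
  instance _ = ℕ._!*_!≢0 a (a ℕ.+ b ∸ a)

C-mul-!-suc : ∀ a b → ((a ℕ.+ b) C a) ℕ.* suc (a ℕ.+ b) ℕ.* (a ! ℕ.* b !) ≡ suc (a ℕ.+ b) !
C-mul-!-suc a b = begin
  ((a ℕ.+ b) C a) ℕ.* suc (a ℕ.+ b) ℕ.* (a ! ℕ.* b !)    ≡⟨ swap ((a ℕ.+ b) C a) (suc (a ℕ.+ b)) (a ! ℕ.* b !) ⟩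
  suc (a ℕ.+ b) ℕ.* (((a ℕ.+ b) C a) ℕ.* (a ! ℕ.* b !))  ≡⟨ cong (suc (a ℕ.+ b) ℕ.*_) (C-mul-! a b) ⟩
  suc (a ℕ.+ b) !                                        ∎
  where
  swap : ∀ x s d → x ℕ.* s ℕ.* d ≡ s ℕ.* (x ℕ.* d)
  swap = solve-∀

C-sym : ∀ a b → (a ℕ.+ b) C a ≡ (a ℕ.+ b) C b
C-sym a b = trans (nCk≡nC[n∸k] (ℕ.m≤m+n a b)) (cong ((a ℕ.+ b) C_) (ℕ.m+n∸m≡n a b))

C-absorb : ∀ a b → ((suc a ℕ.+ b) C suc a) ℕ.* suc a ≡ ((a ℕ.+ b) C a) ℕ.* suc (a ℕ.+ b)
C-absorb a b = ℕ.*-cancelʳ-≡ _ _ (a ! ℕ.* b !) {{ℕ._!*_!≢0 a b}} (begin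
  ((suc a ℕ.+ b) C suc a) ℕ.* suc a ℕ.* (a ! ℕ.* b !)    ≡⟨ reassoc ((suc a ℕ.+ b) C suc a) (suc a) (a !) (b !) ⟩
  ((suc a ℕ.+ b) C suc a) ℕ.* (suc a ! ℕ.* b !)         ≡⟨ C-mul-! (suc a) b ⟩
  suc (a ℕ.+ b) !                                        ≡⟨ C-mul-!-suc a b ⟨
  ((a ℕ.+ b) C a) ℕ.* suc (a ℕ.+ b) ℕ.* (a ! ℕ.* b !)    ∎)
  where
  reassoc : ∀ x s f g → x ℕ.* s ℕ.* (f ℕ.* g) ≡ x ℕ.* (s ℕ.* f ℕ.* g)
  reassoc = solve-∀

C-suc-top : ∀ a b → ((a ℕ.+ suc b) C a) ℕ.* suc b ≡ ((a ℕ.+ b) C a) ℕ.* suc (a ℕ.+ b)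
C-suc-top a b = ℕ.*-cancelʳ-≡ _ _ (a ! ℕ.* b !) {{ℕ._!*_!≢0 a b}} (begin
  ((a ℕ.+ suc b) C a) ℕ.* suc b ℕ.* (a ! ℕ.* b !)        ≡⟨ reassoc ((a ℕ.+ suc b) C a) (suc b) (a !) (b !) ⟩
  ((a ℕ.+ suc b) C a) ℕ.* (a ! ℕ.* suc b !)             ≡⟨ C-mul-! a (suc b) ⟩
  (a ℕ.+ suc b) !                                        ≡⟨ cong _! (ℕ.+-suc a b) ⟩
  suc (a ℕ.+ b) !                                        ≡⟨ C-mul-!-suc a b ⟨
  ((a ℕ.+ b) C a) ℕ.* suc (a ℕ.+ b) ℕ.* (a ! ℕ.* b !)    ∎)
  where
  reassoc : ∀ x s f g → x ℕ.* s ℕ.* (f ℕ.* g) ≡ x ℕ.* (f ℕ.* (s ℕ.* g))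
  reassoc = solve-∀

C-suc-top′ : ∀ {m k} → k ≤ m → ((suc m) C k) ℕ.* (suc m ∸ k) ≡ (m C k) ℕ.* suc m
C-suc-top′ {m} {k} k≤m = subst (λ t → ((suc t) C k) ℕ.* (suc t ∸ k) ≡ (t C k) ℕ.* suc t) (ℕ.m+[n∸m]≡n k≤m)
  (subst (λ t → (t C k) ℕ.* (t ∸ k) ≡ ((k ℕ.+ d) C k) ℕ.* suc (k ℕ.+ d)) (ℕ.+-suc k d)
    (trans (cong (((k ℕ.+ suc d) C k) ℕ.*_) (ℕ.m+n∸m≡n k (suc d))) (C-suc-top k d)))
  where
  d = m ∸ k

binom≢0 : ∀ a b → binom (a ℕ.+ b) a ≢ 0ℚ
binom≢0 a b C≡0 = ℕ.≢-nonZero⁻¹ ((a ℕ.+ b) !) {{ℕ._!≢0 (a ℕ.+ b)}}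
  (trans (sym (C-mul-! a b)) (cong (ℕ._* (a ! ℕ.* b !)) (⟦⟧-injective {(a ℕ.+ b) C a} {0} C≡0)))

binom-absorb : ∀ a b → binom (suc a ℕ.+ b) (suc a) * ⟦ suc a ⟧ ≡ binom (a ℕ.+ b) a * ⟦ suc (a ℕ.+ b) ⟧
binom-absorb a b = ⟦⟧-cast-* {(suc a ℕ.+ b) C suc a} {suc a} {(a ℕ.+ b) C a} {suc (a ℕ.+ b)} (C-absorb a b)

binom-suc-top : ∀ a b → binom (a ℕ.+ suc b) a * ⟦ suc b ⟧ ≡ binom (a ℕ.+ b) a * ⟦ suc (a ℕ.+ b) ⟧
binom-suc-top a b = ⟦⟧-cast-* {(a ℕ.+ suc b) C a} {suc b} {(a ℕ.+ b) C a} {suc (a ℕ.+ b)} (C-suc-top a b)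

binom-sym : ∀ a b → binom (a ℕ.+ b) a ≡ binom (a ℕ.+ b) b
binom-sym a b = cong ⟦_⟧ (C-sym a b)

binom-diagonal : ∀ n → binom n n ≡ 1ℚ
binom-diagonal n = cong ⟦_⟧ (nCn≡1 n)

central-binom : ∀ n → binom (suc n ℕ.+ suc n) (suc n) ≡ ⟦ 2 ⟧ * binom (n ℕ.+ suc n) n
central-binom n = *-cancelʳ (⟦suc⟧≢0 n) (begin
  binom (suc n ℕ.+ suc n) (suc n) * ⟦ suc n ⟧  ≡⟨ binom-absorb n (suc n) ⟩
  binom (n ℕ.+ suc n) n * ⟦ suc n ℕ.+ suc n ⟧  ≡⟨ cong (binom (n ℕ.+ suc n) n *_) (⟦⟧-homo-+ (suc n) (suc n)) ⟩
  binom (n ℕ.+ suc n) n * (⟦ suc n ⟧ + ⟦ suc n ⟧) ≡⟨ double (binom (n ℕ.+ suc n) n) ⟦ suc n ⟧ ⟩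
  ⟦ 2 ⟧ * binom (n ℕ.+ suc n) n * ⟦ suc n ⟧    ∎)
  where
  double : ∀ b N → b * (N + N) ≡ ⟦ 2 ⟧ * b * N
  double b N = solve (b ∷ N ∷ []) ℚ-ring

sign-square : ∀ k → sign k * sign k ≡ 1ℚ
sign-square zero    = refl
sign-square (suc k) = trans (neg-square (sign k)) (sign-square k)
  where
  neg-square : ∀ s → - s * - s ≡ s * s
  neg-square s = solve (s ∷ []) ℚ-ring

sign-∸ : ∀ {n m} → n ≤ m → sign (suc m ∸ n) ≡ - (sign (suc n) * sign (suc m))
sign-∸ {zero}  {m}     _         = flip₁ (sign (suc m))
  where
  flip₁ : ∀ s → s ≡ - (- 1ℚ * s)
  flip₁ s = solve (s ∷ []) ℚ-ring
sign-∸ {suc n} {suc m} (s≤s n≤m) = trans (sign-∸ n≤m) (flip₂ (sign (suc n)) (sign (suc m)))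
  where
  flip₂ : ∀ a b → - (a * b) ≡ - (- a * - b)
  flip₂ a b = solve (a ∷ b ∷ []) ℚ-ring

H-suc : ∀ N → H 1 (suc N) ≡ H 1 N + inv ⟦ suc N ⟧
H-suc N = cong (λ p → H 1 N + inv p) (ℚ.*-identityʳ ⟦ suc N ⟧)

sumCount-cong : ∀ a c {f g : ℕ → ℚ} → (∀ i → i < c → f (a ℕ.+ i) ≡ g (a ℕ.+ i)) → sumCount a c f ≡ sumCount a c g
sumCount-cong a zero    f≗g = refl
sumCount-cong a (suc c) f≗g = cong₂ _+_ (sumCount-cong a c (λ i i<c → f≗g i (ℕ.m<n⇒m<1+n i<c))) (f≗g c (ℕ.n<1+n c))

sumCount-+ : ∀ a c (f g : ℕ → ℚ) → sumCount a c (λ k → f k + g k) ≡ sumCount a c f + sumCount a c g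
sumCount-+ a zero    f g = refl
sumCount-+ a (suc c) f g = trans (cong (_+ (f (a ℕ.+ c) + g (a ℕ.+ c))) (sumCount-+ a c f g))
  (interchange (sumCount a c f) (sumCount a c g) (f (a ℕ.+ c)) (g (a ℕ.+ c)))
  where
  interchange : ∀ p q r s → (p + q) + (r + s) ≡ (p + r) + (q + s)
  interchange p q r s = solve (p ∷ q ∷ r ∷ s ∷ []) ℚ-ring

sumCount-*ʳ : ∀ a c (f : ℕ → ℚ) x → sumCount a c (λ k → f k * x) ≡ sumCount a c f * x
sumCount-*ʳ a zero    f x = sym (ℚ.*-zeroˡ x)
sumCount-*ʳ a (suc c) f x = trans (cong (_+ f (a ℕ.+ c) * x) (sumCount-*ʳ a c f x))
  (sym (ℚ.*-distribʳ-+ x (sumCount a c f) (f (a ℕ.+ c))))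

sumCount-split : ∀ a b c (f : ℕ → ℚ) → sumCount a (b ℕ.+ c) f ≡ sumCount a b f + sumCount (a ℕ.+ b) c f
sumCount-split a b zero    f = trans (cong (λ d → sumCount a d f) (ℕ.+-identityʳ b)) (sym (ℚ.+-identityʳ _))
sumCount-split a b (suc c) f = begin
  sumCount a (b ℕ.+ suc c) f                                           ≡⟨ cong (λ d → sumCount a d f) (ℕ.+-suc b c) ⟩
  sumCount a (b ℕ.+ c) f + f (a ℕ.+ (b ℕ.+ c))                         ≡⟨ cong₂ _+_ (sumCount-split a b c f)
                                                                                     (cong f (sym (ℕ.+-assoc a b c))) ⟩
  sumCount a b f + sumCount (a ℕ.+ b) c f + f (a ℕ.+ b ℕ.+ c)          ≡⟨ ℚ.+-assoc (sumCount a b f) _ _ ⟩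
  sumCount a b f + sumCount (a ℕ.+ b) (suc c) f                        ∎

-- Partial fraction expansions and multiplication by a ratio

Regular : ℕ → ℚ → Set
Regular K y = ∀ j → j ≤ K → y + ⟦ j ⟧ ≢ 0ℚ

Regular-≤ : ∀ {K L y} → K ≤ L → Regular L y → Regular K y
Regular-≤ K≤L y-reg j j≤K = y-reg j (ℕ.≤-trans j≤K K≤L)

Regular-pole : ∀ {K N} → K < N → Regular K (- ⟦ N ⟧)
Regular-pole K<N j j≤K = -⟦N⟧+⟦k⟧≢0 (ℕ.≤-<-trans j≤K K<N)

pole : ℚ → ℕ → ℚ
pole y k = inv (y + ⟦ k ⟧)

pfTerm : (ℕ → ℚ) → (ℕ → ℚ) → ℚ → ℕ → ℚ
pfTerm A B y k = A k * (pole y k * pole y k) + B k * pole y k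

-- Primed names are formal derivatives with respect to y.
pfTerm′ : (ℕ → ℚ) → (ℕ → ℚ) → ℚ → ℕ → ℚ
pfTerm′ A B y k = - (⟦ 2 ⟧ * A k * (pole y k * pole y k * pole y k)) - B k * (pole y k * pole y k)

pf : ℕ → (ℕ → ℚ) → (ℕ → ℚ) → ℚ → ℚ
pf K A B y = sumFromTo 0 K (pfTerm A B y)

pf′ : ℕ → (ℕ → ℚ) → (ℕ → ℚ) → ℚ → ℚ
pf′ K A B y = sumFromTo 0 K (pfTerm′ A B y)

pf-cong : ∀ {A A′ B B′} K y → (∀ k → k ≤ K → A k ≡ A′ k) → (∀ k → k ≤ K → B k ≡ B′ k) →
  pf K A B y ≡ pf K A′ B′ y
pf-cong {A} {A′} {B} {B′} K y A≗A′ B≗B′ = sumCount-cong 0 (suc K) λ k k<1+K →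
  cong₂ (λ a b → a * (pole y k * pole y k) + b * pole y k) (A≗A′ k (ℕ.s≤s⁻¹ k<1+K)) (B≗B′ k (ℕ.s≤s⁻¹ k<1+K))

pf′-cong : ∀ {A A′ B B′} K y → (∀ k → k ≤ K → A k ≡ A′ k) → (∀ k → k ≤ K → B k ≡ B′ k) →
  pf′ K A B y ≡ pf′ K A′ B′ y
pf′-cong {A} {A′} {B} {B′} K y A≗A′ B≗B′ = sumCount-cong 0 (suc K) λ k k<1+K →
  cong₂ (λ a b → - (⟦ 2 ⟧ * a * (pole y k * pole y k * pole y k)) - b * (pole y k * pole y k))
    (A≗A′ k (ℕ.s≤s⁻¹ k<1+K)) (B≗B′ k (ℕ.s≤s⁻¹ k<1+K))

ratio : ℕ → ℚ → ℚ
ratio N y = ⟦ 2 ⟧ * ⟦ N ⟧ * pole y N - 1ℚ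

ratio′ : ℕ → ℚ → ℚ
ratio′ N y = - (⟦ 2 ⟧ * ⟦ N ⟧ * (pole y N * pole y N))

gain : ℕ → ℕ → ℚ
gain N k = - (⟦ 2 ⟧ * ⟦ N ⟧ * pole (- ⟦ N ⟧) k + 1ℚ)

ratioCoeff₂ : ℕ → (ℕ → ℚ) → ℕ → ℚ
ratioCoeff₂ N A k = gain N k * A k

ratioCoeff₁ : ℕ → (ℕ → ℚ) → (ℕ → ℚ) → ℕ → ℚ
ratioCoeff₁ N A B k = gain N k * B k - ⟦ 2 ⟧ * ⟦ N ⟧ * (pole (- ⟦ N ⟧) k * pole (- ⟦ N ⟧) k) * A k

reciprocal-relation : ∀ (y K N u v c : ℚ) → u * (y + K) ≡ 1ℚ → v * (y + N) ≡ 1ℚ → c * (- N + K) ≡ 1ℚ →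
  v * (u - c) ≡ - (u * c)
reciprocal-relation y K N u v c hu hv hc = begin
  v * (u - c)                                     ≡⟨ solve (u ∷ v ∷ c ∷ []) ℚ-ring ⟩
  v * u * 1ℚ - v * c * 1ℚ                         ≡⟨ cong₂ (λ p q → v * u * p - v * c * q) (sym hc) (sym hu) ⟩
  v * u * (c * (- N + K)) - v * c * (u * (y + K)) ≡⟨ solve (y ∷ K ∷ N ∷ u ∷ v ∷ c ∷ []) ℚ-ring ⟩
  - (u * c) * (v * (y + N))                       ≡⟨ cong (λ p → - (u * c) * p) hv ⟩
  - (u * c) * 1ℚ                                  ≡⟨ ℚ.*-identityʳ (- (u * c)) ⟩
  - (u * c)                                       ∎

pole-relation : ∀ {y k N} → y + ⟦ k ⟧ ≢ 0ℚ → y + ⟦ N ⟧ ≢ 0ℚ → k < N →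
  pole y N * (pole y k - pole (- ⟦ N ⟧) k) ≡ - (pole y k * pole (- ⟦ N ⟧) k)
pole-relation {y} {k} {N} y+k≢0 y+N≢0 k<N = reciprocal-relation y ⟦ k ⟧ ⟦ N ⟧ (pole y k) (pole y N) (pole (- ⟦ N ⟧) k)
  (inv-inverseˡ y+k≢0) (inv-inverseˡ y+N≢0) (inv-inverseˡ (-⟦N⟧+⟦k⟧≢0 k<N))

-- With T y = a u² + b u: T y - T (-N) = (u - c) (a (u + c) + b), and the hypothesis turns v (u - c) into -(u c).
term-ratio : ∀ (a b u v c N : ℚ) → v * (u - c) ≡ - (u * c) →
  (a * (u * u) + b * u) * (⟦ 2 ⟧ * N * v - 1ℚ)
    ≡ - (⟦ 2 ⟧ * N * c + 1ℚ) * a * (u * u) + (- (⟦ 2 ⟧ * N * c + 1ℚ) * b - ⟦ 2 ⟧ * N * (c * c) * a) * u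
      + (a * (c * c) + b * c) * (⟦ 2 ⟧ * N * v)
term-ratio a b u v c N rel = begin
  (a * (u * u) + b * u) * (⟦ 2 ⟧ * N * v - 1ℚ)
    ≡⟨ solve (a ∷ b ∷ u ∷ v ∷ c ∷ N ∷ []) ℚ-ring ⟩
  (a * (c * c) + b * c) * (⟦ 2 ⟧ * N * v) + ⟦ 2 ⟧ * N * (a * (u + c) + b) * (v * (u - c)) - (a * (u * u) + b * u)
    ≡⟨ cong (λ w → (a * (c * c) + b * c) * (⟦ 2 ⟧ * N * v) + ⟦ 2 ⟧ * N * (a * (u + c) + b) * w - (a * (u * u) + b * u)) rel ⟩
  (a * (c * c) + b * c) * (⟦ 2 ⟧ * N * v) + ⟦ 2 ⟧ * N * (a * (u + c) + b) * - (u * c) - (a * (u * u) + b * u)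
    ≡⟨ solve (a ∷ b ∷ u ∷ v ∷ c ∷ N ∷ []) ℚ-ring ⟩
  - (⟦ 2 ⟧ * N * c + 1ℚ) * a * (u * u) + (- (⟦ 2 ⟧ * N * c + 1ℚ) * b - ⟦ 2 ⟧ * N * (c * c) * a) * u
      + (a * (c * c) + b * c) * (⟦ 2 ⟧ * N * v) ∎

term-ratio′ : ∀ (a b u v c N : ℚ) → v * (u - c) ≡ - (u * c) →
  (- (⟦ 2 ⟧ * a * (u * u * u)) - b * (u * u)) * (⟦ 2 ⟧ * N * v - 1ℚ) + (a * (u * u) + b * u) * - (⟦ 2 ⟧ * N * (v * v))
    ≡ - (⟦ 2 ⟧ * (- (⟦ 2 ⟧ * N * c + 1ℚ) * a) * (u * u * u))
      - (- (⟦ 2 ⟧ * N * c + 1ℚ) * b - ⟦ 2 ⟧ * N * (c * c) * a) * (u * u)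
      + (a * (c * c) + b * c) * - (⟦ 2 ⟧ * N * (v * v))
term-ratio′ a b u v c N rel = begin
  (- (⟦ 2 ⟧ * a * (u * u * u)) - b * (u * u)) * (⟦ 2 ⟧ * N * v - 1ℚ) + (a * (u * u) + b * u) * - (⟦ 2 ⟧ * N * (v * v))
    ≡⟨ solve (a ∷ b ∷ u ∷ v ∷ c ∷ N ∷ []) ℚ-ring ⟩
  (a * (c * c) + b * c) * - (⟦ 2 ⟧ * N * (v * v)) - (- (⟦ 2 ⟧ * a * (u * u * u)) - b * (u * u))
    + ⟦ 2 ⟧ * N * (v * (u - c)) * (- (⟦ 2 ⟧ * a * (u * u)) - (a * c + b) * u)
    - ⟦ 2 ⟧ * N * v * (v * (u - c) + u * c) * (a * (u + c) + b)
    ≡⟨ cong₂ E rel rel ⟩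
  (a * (c * c) + b * c) * - (⟦ 2 ⟧ * N * (v * v)) - (- (⟦ 2 ⟧ * a * (u * u * u)) - b * (u * u))
    + ⟦ 2 ⟧ * N * - (u * c) * (- (⟦ 2 ⟧ * a * (u * u)) - (a * c + b) * u)
    - ⟦ 2 ⟧ * N * v * (- (u * c) + u * c) * (a * (u + c) + b)
    ≡⟨ solve (a ∷ b ∷ u ∷ v ∷ c ∷ N ∷ []) ℚ-ring ⟩
  - (⟦ 2 ⟧ * (- (⟦ 2 ⟧ * N * c + 1ℚ) * a) * (u * u * u))
    - (- (⟦ 2 ⟧ * N * c + 1ℚ) * b - ⟦ 2 ⟧ * N * (c * c) * a) * (u * u)
    + (a * (c * c) + b * c) * - (⟦ 2 ⟧ * N * (v * v)) ∎
  where
  E : ℚ → ℚ → ℚ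
  E w z = (a * (c * c) + b * c) * - (⟦ 2 ⟧ * N * (v * v)) - (- (⟦ 2 ⟧ * a * (u * u * u)) - b * (u * u))
    + ⟦ 2 ⟧ * N * w * (- (⟦ 2 ⟧ * a * (u * u)) - (a * c + b) * u)
    - ⟦ 2 ⟧ * N * v * (z + u * c) * (a * (u + c) + b)

term-ratio-at-pole : ∀ (a b c N : ℚ) →
  (- (⟦ 2 ⟧ * N * c + 1ℚ) * a * (c * c) + (- (⟦ 2 ⟧ * N * c + 1ℚ) * b - ⟦ 2 ⟧ * N * (c * c) * a) * c) + (a * (c * c) + b * c)
    ≡ (- (⟦ 2 ⟧ * a * (c * c * c)) - b * (c * c)) * (⟦ 2 ⟧ * N)
term-ratio-at-pole a b c N = solve (a ∷ b ∷ c ∷ N ∷ []) ℚ-ring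

pf-ratio : ∀ {K N} A B y → K < N → Regular K y → y + ⟦ N ⟧ ≢ 0ℚ →
  pf K A B y * ratio N y ≡ pf K (ratioCoeff₂ N A) (ratioCoeff₁ N A B) y + pf K A B (- ⟦ N ⟧) * (⟦ 2 ⟧ * ⟦ N ⟧ * pole y N)
pf-ratio {K} {N} A B y K<N y-reg y+N≢0 = begin
  pf K A B y * ratio N y
    ≡⟨ sumCount-*ʳ 0 (suc K) (pfTerm A B y) (ratio N y) ⟨
  sumCount 0 (suc K) (λ k → pfTerm A B y k * ratio N y)
    ≡⟨ sumCount-cong 0 (suc K) per-term ⟩
  sumCount 0 (suc K) (λ k → pfTerm (ratioCoeff₂ N A) (ratioCoeff₁ N A B) y k + pfTerm A B (- ⟦ N ⟧) k * (⟦ 2 ⟧ * ⟦ N ⟧ * pole y N))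
    ≡⟨ sumCount-+ 0 (suc K) _ _ ⟩
  pf K (ratioCoeff₂ N A) (ratioCoeff₁ N A B) y + sumCount 0 (suc K) (λ k → pfTerm A B (- ⟦ N ⟧) k * (⟦ 2 ⟧ * ⟦ N ⟧ * pole y N))
    ≡⟨ cong (pf K (ratioCoeff₂ N A) (ratioCoeff₁ N A B) y +_) (sumCount-*ʳ 0 (suc K) _ _) ⟩
  pf K (ratioCoeff₂ N A) (ratioCoeff₁ N A B) y + pf K A B (- ⟦ N ⟧) * (⟦ 2 ⟧ * ⟦ N ⟧ * pole y N) ∎
  where
  per-term : ∀ k → k < suc K → pfTerm A B y k * ratio N y
    ≡ pfTerm (ratioCoeff₂ N A) (ratioCoeff₁ N A B) y k + pfTerm A B (- ⟦ N ⟧) k * (⟦ 2 ⟧ * ⟦ N ⟧ * pole y N)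
  per-term k k<1+K = term-ratio (A k) (B k) (pole y k) (pole y N) (pole (- ⟦ N ⟧) k) ⟦ N ⟧
    (pole-relation {y} (y-reg k (ℕ.s≤s⁻¹ k<1+K)) y+N≢0 (ℕ.≤-<-trans (ℕ.s≤s⁻¹ k<1+K) K<N))

pf-ratio′ : ∀ {K N} A B y → K < N → Regular K y → y + ⟦ N ⟧ ≢ 0ℚ →
  pf′ K A B y * ratio N y + pf K A B y * ratio′ N y
    ≡ pf′ K (ratioCoeff₂ N A) (ratioCoeff₁ N A B) y + pf K A B (- ⟦ N ⟧) * ratio′ N y
pf-ratio′ {K} {N} A B y K<N y-reg y+N≢0 = begin
  pf′ K A B y * ratio N y + pf K A B y * ratio′ N y
    ≡⟨ cong₂ _+_ (sumCount-*ʳ 0 (suc K) (pfTerm′ A B y) (ratio N y)) (sumCount-*ʳ 0 (suc K) (pfTerm A B y) (ratio′ N y)) ⟨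
  sumCount 0 (suc K) (λ k → pfTerm′ A B y k * ratio N y) + sumCount 0 (suc K) (λ k → pfTerm A B y k * ratio′ N y)
    ≡⟨ sumCount-+ 0 (suc K) _ _ ⟨
  sumCount 0 (suc K) (λ k → pfTerm′ A B y k * ratio N y + pfTerm A B y k * ratio′ N y)
    ≡⟨ sumCount-cong 0 (suc K) per-term ⟩
  sumCount 0 (suc K) (λ k → pfTerm′ (ratioCoeff₂ N A) (ratioCoeff₁ N A B) y k + pfTerm A B (- ⟦ N ⟧) k * ratio′ N y)
    ≡⟨ sumCount-+ 0 (suc K) _ _ ⟩
  pf′ K (ratioCoeff₂ N A) (ratioCoeff₁ N A B) y + sumCount 0 (suc K) (λ k → pfTerm A B (- ⟦ N ⟧) k * ratio′ N y)
    ≡⟨ cong (pf′ K (ratioCoeff₂ N A) (ratioCoeff₁ N A B) y +_) (sumCount-*ʳ 0 (suc K) _ _) ⟩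
  pf′ K (ratioCoeff₂ N A) (ratioCoeff₁ N A B) y + pf K A B (- ⟦ N ⟧) * ratio′ N y ∎
  where
  per-term : ∀ k → k < suc K → pfTerm′ A B y k * ratio N y + pfTerm A B y k * ratio′ N y
    ≡ pfTerm′ (ratioCoeff₂ N A) (ratioCoeff₁ N A B) y k + pfTerm A B (- ⟦ N ⟧) k * ratio′ N y
  per-term k k<1+K = term-ratio′ (A k) (B k) (pole y k) (pole y N) (pole (- ⟦ N ⟧) k) ⟦ N ⟧
    (pole-relation {y} (y-reg k (ℕ.s≤s⁻¹ k<1+K)) y+N≢0 (ℕ.≤-<-trans (ℕ.s≤s⁻¹ k<1+K) K<N))

pf-ratio-at-pole : ∀ K N A B →
  pf K (ratioCoeff₂ N A) (ratioCoeff₁ N A B) (- ⟦ N ⟧) + pf K A B (- ⟦ N ⟧) ≡ pf′ K A B (- ⟦ N ⟧) * (⟦ 2 ⟧ * ⟦ N ⟧)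
pf-ratio-at-pole K N A B = begin
  pf K (ratioCoeff₂ N A) (ratioCoeff₁ N A B) (- ⟦ N ⟧) + pf K A B (- ⟦ N ⟧)
    ≡⟨ sumCount-+ 0 (suc K) _ _ ⟨
  sumCount 0 (suc K) (λ k → pfTerm (ratioCoeff₂ N A) (ratioCoeff₁ N A B) (- ⟦ N ⟧) k + pfTerm A B (- ⟦ N ⟧) k)
    ≡⟨ sumCount-cong 0 (suc K) (λ k _ → term-ratio-at-pole (A k) (B k) (pole (- ⟦ N ⟧) k) ⟦ N ⟧) ⟩
  sumCount 0 (suc K) (λ k → pfTerm′ A B (- ⟦ N ⟧) k * (⟦ 2 ⟧ * ⟦ N ⟧))
    ≡⟨ sumCount-*ʳ 0 (suc K) _ _ ⟩
  pf′ K A B (- ⟦ N ⟧) * (⟦ 2 ⟧ * ⟦ N ⟧) ∎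

-- The quotients R j y = (1 - y)_j / (y)_(j+1) at the poles

R : ℕ → ℚ → ℚ
R zero    y = pole y 0
R (suc j) y = R j y * ratio (suc j) y

R′ : ℕ → ℚ → ℚ
R′ zero    y = - (pole y 0 * pole y 0)
R′ (suc j) y = R′ j y * ratio (suc j) y + R j y * ratio′ (suc j) y

rising≢0 : ∀ {x} j → Regular j x → rising x (suc j) ≢ 0ℚ
rising≢0 zero    x-reg eq = x-reg 0 z≤n (trans (sym (ℚ.*-identityˡ _)) eq)
rising≢0 {x} (suc j) x-reg = *-≢0 (rising≢0 j (Regular-≤ {y = x} (ℕ.n≤1+n j) x-reg)) (x-reg (suc j) ℕ.≤-refl)

rising-step : ∀ (x j u : ℚ) → u * (x + (1ℚ + j)) ≡ 1ℚ → (1ℚ - x + j) * u ≡ ⟦ 2 ⟧ * (1ℚ + j) * u - 1ℚ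
rising-step x j u hu = begin
  (1ℚ - x + j) * u                                ≡⟨ solve (x ∷ j ∷ u ∷ []) ℚ-ring ⟩
  ⟦ 2 ⟧ * (1ℚ + j) * u - u * (x + (1ℚ + j))       ≡⟨ cong (λ w → ⟦ 2 ⟧ * (1ℚ + j) * u - w) hu ⟩
  ⟦ 2 ⟧ * (1ℚ + j) * u - 1ℚ                       ∎

rising-quotient : ∀ {x} j → Regular j x → rising (1ℚ - x) j * inv (rising x (suc j)) ≡ R j x
rising-quotient {x} zero x-reg = trans (ℚ.*-identityˡ _) (cong inv (ℚ.*-identityˡ (x + ⟦ 0 ⟧)))
rising-quotient {x} (suc j) x-reg = begin
  rising (1ℚ - x) j * (1ℚ - x + ⟦ j ⟧) * inv (rising x (suc j) * (x + ⟦ suc j ⟧))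
    ≡⟨ cong (rising (1ℚ - x) j * (1ℚ - x + ⟦ j ⟧) *_) (inv-distrib-* (rising≢0 j x-reg′) x+j+1≢0) ⟩
  rising (1ℚ - x) j * (1ℚ - x + ⟦ j ⟧) * (inv (rising x (suc j)) * pole x (suc j))
    ≡⟨ interchange (rising (1ℚ - x) j) (1ℚ - x + ⟦ j ⟧) (inv (rising x (suc j))) (pole x (suc j)) ⟩
  rising (1ℚ - x) j * inv (rising x (suc j)) * ((1ℚ - x + ⟦ j ⟧) * pole x (suc j))
    ≡⟨ cong₂ _*_ (rising-quotient j x-reg′) last-factor ⟩
  R j x * ratio (suc j) x ∎
  where
  x-reg′ : Regular j x
  x-reg′ = Regular-≤ {y = x} (ℕ.n≤1+n j) x-reg
  x+j+1≢0 = x-reg (suc j) ℕ.≤-refl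
  interchange : ∀ a b c d → a * b * (c * d) ≡ a * c * (b * d)
  interchange a b c d = solve (a ∷ b ∷ c ∷ d ∷ []) ℚ-ring
  last-factor : (1ℚ - x + ⟦ j ⟧) * pole x (suc j) ≡ ratio (suc j) x
  last-factor = begin
    (1ℚ - x + ⟦ j ⟧) * pole x (suc j)           ≡⟨ rising-step x ⟦ j ⟧ (pole x (suc j))
                                                      (subst (λ J → pole x (suc j) * (x + J) ≡ 1ℚ) (⟦suc⟧ j) (inv-inverseˡ x+j+1≢0)) ⟩
    ⟦ 2 ⟧ * (1ℚ + ⟦ j ⟧) * pole x (suc j) - 1ℚ  ≡⟨ cong (λ J → ⟦ 2 ⟧ * J * pole x (suc j) - 1ℚ) (sym (⟦suc⟧ j)) ⟩
    ratio (suc j) x                             ∎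

ratio-at-pole : ∀ (N J c : ℚ) → c * (- N + J) ≡ 1ℚ → (⟦ 2 ⟧ * J * c - 1ℚ) * (N - J) ≡ - (J + N)
ratio-at-pole N J c hc = begin
  (⟦ 2 ⟧ * J * c - 1ℚ) * (N - J)                ≡⟨ solve (N ∷ J ∷ c ∷ []) ℚ-ring ⟩
  - (⟦ 2 ⟧ * J * (c * (- N + J)) + (N - J))     ≡⟨ cong (λ w → - (⟦ 2 ⟧ * J * w + (N - J))) hc ⟩
  - (⟦ 2 ⟧ * J * 1ℚ + (N - J))                  ≡⟨ solve (N ∷ J ∷ []) ℚ-ring ⟩
  - (J + N)                                     ∎

pole-at-zero : ∀ (N c : ℚ) → c * (- N + 0ℚ) ≡ 1ℚ → N * 1ℚ * c ≡ - 1ℚ * 1ℚ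
pole-at-zero N c hc = begin
  N * 1ℚ * c                ≡⟨ solve (N ∷ c ∷ []) ℚ-ring ⟩
  - (c * (- N + 0ℚ)) * 1ℚ   ≡⟨ cong (λ w → - w * 1ℚ) hc ⟩
  - 1ℚ * 1ℚ                 ∎

R-at-pole-step : ∀ (N b b′ J S ρ r σ V V′ JN : ℚ) →
  b * J ≡ b′ * S → N * b′ * ρ ≡ σ * V → r * S ≡ - JN → V′ * J ≡ V * JN →
  N * b * (ρ * r) * J ≡ - σ * V′ * J
R-at-pole-step N b b′ J S ρ r σ V V′ JN shift IH ratio-S absorb = begin
  N * b * (ρ * r) * J   ≡⟨ solve (N ∷ b ∷ J ∷ ρ ∷ r ∷ []) ℚ-ring ⟩
  N * (b * J) * ρ * r   ≡⟨ cong (λ w → N * w * ρ * r) shift ⟩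
  N * (b′ * S) * ρ * r  ≡⟨ solve (N ∷ b′ ∷ S ∷ ρ ∷ r ∷ []) ℚ-ring ⟩
  N * b′ * ρ * (r * S)  ≡⟨ cong₂ _*_ IH ratio-S ⟩
  σ * V * - JN          ≡⟨ solve (σ ∷ V ∷ JN ∷ []) ℚ-ring ⟩
  - σ * (V * JN)        ≡⟨ cong (- σ *_) (sym absorb) ⟩
  - σ * (V′ * J)        ≡⟨ sym (ℚ.*-assoc (- σ) V′ J) ⟩
  - σ * V′ * J          ∎

≡+suc⇒< : ∀ {N a b} → N ≡ a ℕ.+ suc b → a < N
≡+suc⇒< {N} {a} {b} eq = subst (a <_) (sym eq) (ℕ.m<m+n a (s≤s z≤n))

R-at-pole′ : ∀ j s {N} → N ≡ suc (j ℕ.+ s) →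
  ⟦ N ⟧ * binom (j ℕ.+ s) j * R j (- ⟦ N ⟧) ≡ sign (suc j) * binom (j ℕ.+ N) j
-- Here binom s 0 computes to 1ℚ and sign 1 to - 1ℚ.
R-at-pole′ zero s {N} refl = pole-at-zero ⟦ N ⟧ (pole (- ⟦ N ⟧) 0) (inv-inverseˡ (-⟦N⟧+⟦k⟧≢0 {0} {N} (s≤s z≤n)))
R-at-pole′ (suc j) s {N} eq = *-cancelʳ (⟦suc⟧≢0 j)
  (R-at-pole-step ⟦ N ⟧ _ _ ⟦ suc j ⟧ ⟦ suc s ⟧ (R j (- ⟦ N ⟧)) (ratio (suc j) (- ⟦ N ⟧)) (sign (suc j)) _ _
    ⟦ suc (j ℕ.+ N) ⟧
    (trans (binom-absorb j s) (sym (binom-suc-top j s))) (R-at-pole′ j (suc s) eq′) ratio-S (binom-absorb j N))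
  where
  eq′ : N ≡ suc j ℕ.+ suc s
  eq′ = trans eq (cong suc (sym (ℕ.+-suc j s)))
  ratio-S : ratio (suc j) (- ⟦ N ⟧) * ⟦ suc s ⟧ ≡ - ⟦ suc (j ℕ.+ N) ⟧
  ratio-S = begin
    ratio (suc j) (- ⟦ N ⟧) * ⟦ suc s ⟧              ≡⟨ cong (ratio (suc j) (- ⟦ N ⟧) *_) (⟦⟧-difference (suc j) (suc s) eq′) ⟩
    ratio (suc j) (- ⟦ N ⟧) * (⟦ N ⟧ - ⟦ suc j ⟧)    ≡⟨ ratio-at-pole ⟦ N ⟧ ⟦ suc j ⟧ (pole (- ⟦ N ⟧) (suc j))
                                                         (inv-inverseˡ (-⟦N⟧+⟦k⟧≢0 {suc j} (≡+suc⇒< eq′))) ⟩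
    - (⟦ suc j ⟧ + ⟦ N ⟧)                            ≡⟨ cong -_ (sym (⟦⟧-homo-+ (suc j) N)) ⟩
    - ⟦ suc (j ℕ.+ N) ⟧                              ∎

R-at-pole : ∀ {j N} → j < N → ⟦ N ⟧ * binom (N ∸ 1) j * R j (- ⟦ N ⟧) ≡ sign (suc j) * binom (j ℕ.+ N) j
R-at-pole {j} {N} j<N = subst (λ t → ⟦ N ⟧ * binom t j * R j (- ⟦ N ⟧) ≡ sign (suc j) * binom (j ℕ.+ N) j)
  (cong ℕ.pred N≡) (R-at-pole′ j (N ∸ suc j) (sym N≡))
  where
  N≡ : suc j ℕ.+ (N ∸ suc j) ≡ N
  N≡ = ℕ.m+[n∸m]≡n j<N

-- With c = 1/(J - N), p = 1/(N - J) and q = 1/(N + J): at y = -N, ratio′ J = ratio J * (p - q).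
ratio-log-derivative : ∀ (N J c p q : ℚ) → c * (- N + J) ≡ 1ℚ → p * (N - J) ≡ 1ℚ → q * (N + J) ≡ 1ℚ →
  - (⟦ 2 ⟧ * J * (c * c)) ≡ (⟦ 2 ⟧ * J * c - 1ℚ) * (p - q)
ratio-log-derivative N J c p q hc hp hq = begin
  - (⟦ 2 ⟧ * J * (c * c))
    ≡⟨ cong (λ w → - (⟦ 2 ⟧ * J * (w * w))) c≡-p ⟩
  - (⟦ 2 ⟧ * J * (- p * - p))
    ≡⟨ solve (J ∷ p ∷ q ∷ []) ℚ-ring ⟩
  (⟦ 2 ⟧ * J * - p - 1ℚ) * (p - q) + ((p - q) - ⟦ 2 ⟧ * J * (p * q))
    ≡⟨ cong (λ w → (⟦ 2 ⟧ * J * - p - 1ℚ) * (p - q) + (w - ⟦ 2 ⟧ * J * (p * q))) (reciprocal-difference N J p q hp hq) ⟩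
  (⟦ 2 ⟧ * J * - p - 1ℚ) * (p - q) + (⟦ 2 ⟧ * J * (p * q) - ⟦ 2 ⟧ * J * (p * q))
    ≡⟨ solve (J ∷ p ∷ q ∷ []) ℚ-ring ⟩
  (⟦ 2 ⟧ * J * - p - 1ℚ) * (p - q)
    ≡⟨ cong (λ w → (⟦ 2 ⟧ * J * w - 1ℚ) * (p - q)) (sym c≡-p) ⟩
  (⟦ 2 ⟧ * J * c - 1ℚ) * (p - q) ∎
  where
  c≡-p = reciprocal-neg N J c p hc hp

log-derivative-at-zero : ∀ (N c i h g : ℚ) → c * (- N + 0ℚ) ≡ 1ℚ → i * N ≡ 1ℚ → - (c * c) ≡ c * (i + (h - h) - (g - g))
log-derivative-at-zero N c i h g hc hi = begin
  - (c * c)                         ≡⟨ solve (c ∷ []) ℚ-ring ⟩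
  - (c * c) * 1ℚ                    ≡⟨ cong (λ w → - (c * c) * w) (sym hi) ⟩
  - (c * c) * (i * N)               ≡⟨ solve (N ∷ c ∷ i ∷ []) ℚ-ring ⟩
  c * i * (c * (- N + 0ℚ))          ≡⟨ cong (c * i *_) hc ⟩
  c * i * 1ℚ                        ≡⟨ solve (c ∷ i ∷ h ∷ g ∷ []) ℚ-ring ⟩
  c * (i + (h - h) - (g - g))       ∎

log-derivative-step : ∀ (ρ ρ′ r r′ L L′ d : ℚ) → ρ′ ≡ ρ * L → L′ ≡ L + d → r′ ≡ r * d →
  ρ′ * r + ρ * r′ ≡ ρ * r * L′
log-derivative-step ρ ρ′ r r′ L L′ d hρ hL hr = begin
  ρ′ * r + ρ * r′            ≡⟨ cong₂ (λ a b → a * r + ρ * b) hρ hr ⟩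
  ρ * L * r + ρ * (r * d)    ≡⟨ solve (ρ ∷ r ∷ L ∷ d ∷ []) ℚ-ring ⟩
  ρ * r * (L + d)            ≡⟨ cong (ρ * r *_) (sym hL) ⟩
  ρ * r * L′                 ∎

R′-at-pole′ : ∀ j s {N} → N ≡ suc (j ℕ.+ s) →
  R′ j (- ⟦ N ⟧) ≡ R j (- ⟦ N ⟧) * (inv ⟦ N ⟧ + (H 1 (j ℕ.+ s) - H 1 s) - (H 1 (N ℕ.+ j) - H 1 N))
R′-at-pole′ zero s {N} refl = trans
  (log-derivative-at-zero ⟦ N ⟧ (pole (- ⟦ N ⟧) 0) (inv ⟦ N ⟧) (H 1 s) (H 1 N)
    (inv-inverseˡ (-⟦N⟧+⟦k⟧≢0 {0} {N} (s≤s z≤n))) (inv-inverseˡ (⟦suc⟧≢0 s)))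
  (cong (λ t → pole (- ⟦ N ⟧) 0 * (inv ⟦ N ⟧ + (H 1 s - H 1 s) - (H 1 t - H 1 N))) (sym (ℕ.+-identityʳ N)))
R′-at-pole′ (suc j) s {N} eq = log-derivative-step (R j (- ⟦ N ⟧)) (R′ j (- ⟦ N ⟧)) _ _ _ _ (p - q)
  (R′-at-pole′ j (suc s) eq′) L-step
  (ratio-log-derivative ⟦ N ⟧ ⟦ suc j ⟧ (pole (- ⟦ N ⟧) (suc j)) p q
    (inv-inverseˡ (-⟦N⟧+⟦k⟧≢0 {suc j} (≡+suc⇒< eq′))) p-inverse q-inverse)
  where
  eq′ : N ≡ suc j ℕ.+ suc s
  eq′ = trans eq (cong suc (sym (ℕ.+-suc j s)))
  p = inv ⟦ suc s ⟧
  q = inv ⟦ suc (N ℕ.+ j) ⟧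
  p-inverse : p * (⟦ N ⟧ - ⟦ suc j ⟧) ≡ 1ℚ
  p-inverse = subst (λ S → p * S ≡ 1ℚ) (⟦⟧-difference (suc j) (suc s) eq′) (inv-inverseˡ (⟦suc⟧≢0 s))
  q-inverse : q * (⟦ N ⟧ + ⟦ suc j ⟧) ≡ 1ℚ
  q-inverse = subst (λ S → q * S ≡ 1ℚ) (⟦⟧-homo-+′ N (suc j) (sym (ℕ.+-suc N j))) (inv-inverseˡ (⟦suc⟧≢0 (N ℕ.+ j)))
  L-step : inv ⟦ N ⟧ + (H 1 (suc j ℕ.+ s) - H 1 s) - (H 1 (N ℕ.+ suc j) - H 1 N)
         ≡ inv ⟦ N ⟧ + (H 1 (j ℕ.+ suc s) - H 1 (suc s)) - (H 1 (N ℕ.+ j) - H 1 N) + (p - q)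
  L-step = begin
    inv ⟦ N ⟧ + (H 1 (suc j ℕ.+ s) - H 1 s) - (H 1 (N ℕ.+ suc j) - H 1 N)
      ≡⟨ cong₂ (λ a b → inv ⟦ N ⟧ + (H 1 a - H 1 s) - (b - H 1 N)) (sym (ℕ.+-suc j s))
           (trans (cong (H 1) (ℕ.+-suc N j)) (H-suc (N ℕ.+ j))) ⟩
    inv ⟦ N ⟧ + (H 1 (j ℕ.+ suc s) - H 1 s) - (H 1 (N ℕ.+ j) + q - H 1 N)
      ≡⟨ shuffle (inv ⟦ N ⟧) (H 1 (j ℕ.+ suc s)) (H 1 s) p (H 1 (N ℕ.+ j)) q (H 1 N) ⟩
    inv ⟦ N ⟧ + (H 1 (j ℕ.+ suc s) - (H 1 s + p)) - (H 1 (N ℕ.+ j) - H 1 N) + (p - q)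
      ≡⟨ cong (λ h → inv ⟦ N ⟧ + (H 1 (j ℕ.+ suc s) - h) - (H 1 (N ℕ.+ j) - H 1 N) + (p - q)) (sym (H-suc s)) ⟩
    inv ⟦ N ⟧ + (H 1 (j ℕ.+ suc s) - H 1 (suc s)) - (H 1 (N ℕ.+ j) - H 1 N) + (p - q) ∎
    where
    shuffle : ∀ i a h p b q g → i + (a - h) - (b + q - g) ≡ i + (a - (h + p)) - (b - g) + (p - q)
    shuffle i a h p b q g = solve (i ∷ a ∷ h ∷ p ∷ b ∷ q ∷ g ∷ []) ℚ-ring

R′-at-pole : ∀ {j N} → j < N →
  R′ j (- ⟦ N ⟧) ≡ R j (- ⟦ N ⟧) * (inv ⟦ N ⟧ + (H 1 (N ∸ 1) - H 1 (N ∸ suc j)) - (H 1 (N ℕ.+ j) - H 1 N))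
R′-at-pole {j} {N} j<N = subst
  (λ t → R′ j (- ⟦ N ⟧) ≡ R j (- ⟦ N ⟧) * (inv ⟦ N ⟧ + (H 1 t - H 1 (N ∸ suc j)) - (H 1 (N ℕ.+ j) - H 1 N)))
  (cong ℕ.pred N≡) (R′-at-pole′ j (N ∸ suc j) (sym N≡))
  where
  N≡ : suc j ℕ.+ (N ∸ suc j) ≡ N
  N≡ = ℕ.m+[n∸m]≡n j<N

β : ℕ → ℕ → ℚ
β m k = binom (m ℕ.+ k) k * binom m k

harm : ℕ → ℕ → ℕ → ℚ
harm m n k = H 1 (m ℕ.+ k) + H 1 (m ∸ k) + H 1 (n ℕ.+ k) + H 1 (n ∸ k) - ⟦ 4 ⟧ * H 1 k

choose : ∀ {P : Set} → Dec P → ℚ → ℚ → ℚ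
choose (yes _) a b = a
choose (no _)  a b = b

choose-yes : ∀ {P : Set} (d : Dec P) {a b} → P → choose d a b ≡ a
choose-yes (yes _) p = refl
choose-yes (no ¬p) p = ⊥-elim (¬p p)

choose-no : ∀ {P : Set} (d : Dec P) {a b} → ¬ P → choose d a b ≡ b
choose-no (yes p) ¬p = ⊥-elim (¬p p)
choose-no (no _)  ¬p = refl

doubleCoeff : ℕ → ℕ → ℕ → ℚ
doubleCoeff m n k = choose (k ≤? n) (- ⟦ k ⟧ * (β m k * β n k)) 0ℚ

simpleCoeff : ℕ → ℕ → ℕ → ℚ
simpleCoeff m n k = choose (k ≤? n) (β m k * β n k * (1ℚ + ⟦ k ⟧ * harm m n k))
  (sign (k ∸ n) * β m k * binom (n ℕ.+ k) k * inv (binom (k ∸ 1) n))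

doubleCoeff-≤ : ∀ {m n k} → k ≤ n → doubleCoeff m n k ≡ - ⟦ k ⟧ * (β m k * β n k)
doubleCoeff-≤ {n = n} {k} = choose-yes (k ≤? n)

doubleCoeff-> : ∀ {m n k} → ¬ k ≤ n → doubleCoeff m n k ≡ 0ℚ
doubleCoeff-> {n = n} {k} = choose-no (k ≤? n)

simpleCoeff-≤ : ∀ {m n k} → k ≤ n → simpleCoeff m n k ≡ β m k * β n k * (1ℚ + ⟦ k ⟧ * harm m n k)
simpleCoeff-≤ {n = n} {k} = choose-yes (k ≤? n)

simpleCoeff-> : ∀ {m n k} → ¬ k ≤ n → simpleCoeff m n k ≡ sign (k ∸ n) * β m k * binom (n ℕ.+ k) k * inv (binom (k ∸ 1) n)
simpleCoeff-> {n = n} {k} = choose-no (k ≤? n)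

gain-at-pole : ∀ (M K c : ℚ) → c * (- M + K) ≡ 1ℚ → - (⟦ 2 ⟧ * M * c + 1ℚ) * (M - K) ≡ M + K
gain-at-pole M K c hc = begin
  - (⟦ 2 ⟧ * M * c + 1ℚ) * (M - K)          ≡⟨ solve (M ∷ K ∷ c ∷ []) ℚ-ring ⟩
  ⟦ 2 ⟧ * M * (c * (- M + K)) - (M - K)     ≡⟨ cong (λ w → ⟦ 2 ⟧ * M * w - (M - K)) hc ⟩
  ⟦ 2 ⟧ * M * 1ℚ - (M - K)                  ≡⟨ solve (M ∷ K ∷ []) ℚ-ring ⟩
  M + K                                     ∎

β-step : ∀ (X Y X′ Y′ M D E q : ℚ) → X * M ≡ X′ * E → Y * D ≡ Y′ * M → q * D ≡ E →
  X * Y * (D * M) ≡ q * (X′ * Y′) * (D * M)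
β-step X Y X′ Y′ M D E q top bottom gain-times-gap = begin
  X * Y * (D * M)         ≡⟨ solve (X ∷ Y ∷ M ∷ D ∷ []) ℚ-ring ⟩
  (X * M) * (Y * D)       ≡⟨ cong₂ _*_ top bottom ⟩
  (X′ * E) * (Y′ * M)     ≡⟨ cong (λ w → (X′ * w) * (Y′ * M)) (sym gain-times-gap) ⟩
  (X′ * (q * D)) * (Y′ * M) ≡⟨ solve (X′ ∷ Y′ ∷ M ∷ D ∷ q ∷ []) ℚ-ring ⟩
  q * (X′ * Y′) * (D * M) ∎

β-suc : ∀ {m k} → k ≤ m → β (suc m) k ≡ gain (suc m) k * β m k
β-suc {m} {k} k≤m = *-cancelʳ (*-≢0 D≢0 (⟦suc⟧≢0 m))
  (β-step (binom (suc m ℕ.+ k) k) (binom (suc m) k) (binom (m ℕ.+ k) k) (binom m k)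
    ⟦ suc m ⟧ ⟦ suc m ∸ k ⟧ ⟦ suc (m ℕ.+ k) ⟧ (gain (suc m) k) top bottom gain-times-gap)
  where
  D≢0 : ⟦ suc m ∸ k ⟧ ≢ 0ℚ
  D≢0 = subst (λ t → ⟦ t ⟧ ≢ 0ℚ) (sym (ℕ.+-∸-assoc 1 k≤m)) (⟦suc⟧≢0 (m ∸ k))
  top : binom (suc m ℕ.+ k) k * ⟦ suc m ⟧ ≡ binom (m ℕ.+ k) k * ⟦ suc (m ℕ.+ k) ⟧
  top = subst₂ (λ X X′ → X * ⟦ suc m ⟧ ≡ X′ * ⟦ suc (m ℕ.+ k) ⟧) (binom-sym (suc m) k) (binom-sym m k) (binom-absorb m k)
  bottom : binom (suc m) k * ⟦ suc m ∸ k ⟧ ≡ binom m k * ⟦ suc m ⟧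
  bottom = ⟦⟧-cast-* {suc m C k} {suc m ∸ k} {m C k} {suc m} (C-suc-top′ k≤m)
  gain-times-gap : gain (suc m) k * ⟦ suc m ∸ k ⟧ ≡ ⟦ suc (m ℕ.+ k) ⟧
  gain-times-gap = begin
    gain (suc m) k * ⟦ suc m ∸ k ⟧              ≡⟨ cong (gain (suc m) k *_) (⟦∸⟧ (ℕ.m≤n⇒m≤1+n k≤m)) ⟩
    gain (suc m) k * (⟦ suc m ⟧ - ⟦ k ⟧)        ≡⟨ gain-at-pole ⟦ suc m ⟧ ⟦ k ⟧ _
                                                     (inv-inverseˡ (-⟦N⟧+⟦k⟧≢0 (s≤s k≤m))) ⟩
    ⟦ suc m ⟧ + ⟦ k ⟧                           ≡⟨ ⟦⟧-homo-+ (suc m) k ⟨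
    ⟦ suc (m ℕ.+ k) ⟧                           ∎

harm-suc : ∀ {m n k} → k ≤ m → harm (suc m) n k ≡ harm m n k + inv ⟦ suc (m ℕ.+ k) ⟧ + inv ⟦ suc (m ∸ k) ⟧
harm-suc {m} {n} {k} k≤m = begin
  H 1 (suc (m ℕ.+ k)) + H 1 (suc m ∸ k) + H 1 (n ℕ.+ k) + H 1 (n ∸ k) - ⟦ 4 ⟧ * H 1 k
    ≡⟨ cong₂ (λ a b → a + b + H 1 (n ℕ.+ k) + H 1 (n ∸ k) - ⟦ 4 ⟧ * H 1 k)
         (H-suc (m ℕ.+ k)) (trans (cong (H 1) (ℕ.+-∸-assoc 1 k≤m)) (H-suc (m ∸ k))) ⟩
  (H 1 (m ℕ.+ k) + x) + (H 1 (m ∸ k) + y) + H 1 (n ℕ.+ k) + H 1 (n ∸ k) - ⟦ 4 ⟧ * H 1 k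
    ≡⟨ shuffle (H 1 (m ℕ.+ k)) x (H 1 (m ∸ k)) y (H 1 (n ℕ.+ k)) (H 1 (n ∸ k)) (H 1 k) ⟩
  harm m n k + x + y ∎
  where
  x = inv ⟦ suc (m ℕ.+ k) ⟧
  y = inv ⟦ suc (m ∸ k) ⟧
  shuffle : ∀ a x b y c d h → (a + x) + (b + y) + c + d - ⟦ 4 ⟧ * h ≡ a + b + c + d - ⟦ 4 ⟧ * h + x + y
  shuffle a x b y c d h = solve (a ∷ x ∷ b ∷ y ∷ c ∷ d ∷ h ∷ []) ℚ-ring

harmonic-gain : ∀ (M K c x₁ x₂ : ℚ) → c * (- M + K) ≡ 1ℚ → x₁ * (M + K) ≡ 1ℚ → x₂ * (M - K) ≡ 1ℚ →
  - (⟦ 2 ⟧ * M * c + 1ℚ) * (x₁ + x₂) ≡ ⟦ 2 ⟧ * M * (c * c)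
harmonic-gain M K c x₁ x₂ hc h₁ h₂ = begin
  - (⟦ 2 ⟧ * M * c + 1ℚ) * (x₁ + x₂)
    ≡⟨ cong (λ w → - (⟦ 2 ⟧ * M * w + 1ℚ) * (x₁ + x₂)) c≡-x₂ ⟩
  - (⟦ 2 ⟧ * M * - x₂ + 1ℚ) * (x₁ + x₂)
    ≡⟨ solve (M ∷ x₁ ∷ x₂ ∷ []) ℚ-ring ⟩
  ⟦ 2 ⟧ * M * (- x₂ * - x₂) + ⟦ 2 ⟧ * M * (x₂ * x₁) - (x₂ + x₁)
    ≡⟨ cong (λ w → ⟦ 2 ⟧ * M * (- x₂ * - x₂) + ⟦ 2 ⟧ * M * (x₂ * x₁) - w) (reciprocal-sum M K x₂ x₁ h₂ h₁) ⟩
  ⟦ 2 ⟧ * M * (- x₂ * - x₂) + ⟦ 2 ⟧ * M * (x₂ * x₁) - ⟦ 2 ⟧ * M * (x₂ * x₁)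
    ≡⟨ solve (M ∷ x₁ ∷ x₂ ∷ []) ℚ-ring ⟩
  ⟦ 2 ⟧ * M * (- x₂ * - x₂)
    ≡⟨ cong (λ w → ⟦ 2 ⟧ * M * (w * w)) (sym c≡-x₂) ⟩
  ⟦ 2 ⟧ * M * (c * c) ∎
  where
  c≡-x₂ = reciprocal-neg M K c x₂ hc h₂

simple-step : ∀ (q P₁ P₂ K h x₁ x₂ g : ℚ) → q * (x₁ + x₂) ≡ g →
  q * P₁ * P₂ * (1ℚ + K * (h + x₁ + x₂)) ≡ q * (P₁ * P₂ * (1ℚ + K * h)) - g * (- K * (P₁ * P₂))
simple-step q P₁ P₂ K h x₁ x₂ g hg = begin
  q * P₁ * P₂ * (1ℚ + K * (h + x₁ + x₂))
    ≡⟨ solve (q ∷ P₁ ∷ P₂ ∷ K ∷ h ∷ x₁ ∷ x₂ ∷ []) ℚ-ring ⟩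
  q * (P₁ * P₂ * (1ℚ + K * h)) + K * (P₁ * P₂) * (q * (x₁ + x₂))
    ≡⟨ cong (λ w → q * (P₁ * P₂ * (1ℚ + K * h)) + K * (P₁ * P₂) * w) hg ⟩
  q * (P₁ * P₂ * (1ℚ + K * h)) + K * (P₁ * P₂) * g
    ≡⟨ solve (q ∷ P₁ ∷ P₂ ∷ K ∷ h ∷ g ∷ []) ℚ-ring ⟩
  q * (P₁ * P₂ * (1ℚ + K * h)) - g * (- K * (P₁ * P₂)) ∎

doubleCoeff-suc : ∀ {m n k} → k ≤ m → doubleCoeff (suc m) n k ≡ ratioCoeff₂ (suc m) (doubleCoeff m n) k
doubleCoeff-suc {m} {n} {k} k≤m = [ in-range , out-of-range ]′ (toSum (k ≤? n))
  where
  in-range : k ≤ n → doubleCoeff (suc m) n k ≡ gain (suc m) k * doubleCoeff m n k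
  in-range k≤n = begin
    doubleCoeff (suc m) n k                    ≡⟨ doubleCoeff-≤ k≤n ⟩
    - ⟦ k ⟧ * (β (suc m) k * β n k)            ≡⟨ cong (λ b → - ⟦ k ⟧ * (b * β n k)) (β-suc k≤m) ⟩
    - ⟦ k ⟧ * (gain (suc m) k * β m k * β n k) ≡⟨ pull (gain (suc m) k) ⟦ k ⟧ (β m k) (β n k) ⟩
    gain (suc m) k * (- ⟦ k ⟧ * (β m k * β n k)) ≡⟨ cong (gain (suc m) k *_) (doubleCoeff-≤ k≤n) ⟨
    gain (suc m) k * doubleCoeff m n k         ∎
    where
    pull : ∀ q K b b′ → - K * (q * b * b′) ≡ q * (- K * (b * b′))
    pull q K b b′ = solve (q ∷ K ∷ b ∷ b′ ∷ []) ℚ-ring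
  out-of-range : ¬ k ≤ n → doubleCoeff (suc m) n k ≡ gain (suc m) k * doubleCoeff m n k
  out-of-range k≰n = begin
    doubleCoeff (suc m) n k              ≡⟨ doubleCoeff-> k≰n ⟩
    0ℚ                                   ≡⟨ ℚ.*-zeroʳ (gain (suc m) k) ⟨
    gain (suc m) k * 0ℚ                  ≡⟨ cong (gain (suc m) k *_) (doubleCoeff-> k≰n) ⟨
    gain (suc m) k * doubleCoeff m n k   ∎

simpleCoeff-suc : ∀ {m n k} → k ≤ m → simpleCoeff (suc m) n k ≡ ratioCoeff₁ (suc m) (doubleCoeff m n) (simpleCoeff m n) k
simpleCoeff-suc {m} {n} {k} k≤m = [ in-range , out-of-range ]′ (toSum (k ≤? n))
  where
  M = ⟦ suc m ⟧
  c = pole (- M) k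
  q = gain (suc m) k
  g = ⟦ 2 ⟧ * M * (c * c)
  x₁ = inv ⟦ suc (m ℕ.+ k) ⟧
  x₂ = inv ⟦ suc (m ∸ k) ⟧
  q-harm : q * (x₁ + x₂) ≡ g
  q-harm = harmonic-gain M ⟦ k ⟧ c x₁ x₂ (inv-inverseˡ (-⟦N⟧+⟦k⟧≢0 (s≤s k≤m)))
    (subst (λ t → x₁ * t ≡ 1ℚ) (⟦⟧-homo-+ (suc m) k) (inv-inverseˡ (⟦suc⟧≢0 (m ℕ.+ k))))
    (subst (λ t → x₂ * t ≡ 1ℚ) (trans (cong ⟦_⟧ (sym (ℕ.+-∸-assoc 1 k≤m))) (⟦∸⟧ (ℕ.m≤n⇒m≤1+n k≤m)))
      (inv-inverseˡ (⟦suc⟧≢0 (m ∸ k))))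
  in-range : k ≤ n → simpleCoeff (suc m) n k ≡ q * simpleCoeff m n k - g * doubleCoeff m n k
  in-range k≤n = begin
    simpleCoeff (suc m) n k
      ≡⟨ simpleCoeff-≤ k≤n ⟩
    β (suc m) k * β n k * (1ℚ + ⟦ k ⟧ * harm (suc m) n k)
      ≡⟨ cong₂ (λ b h → b * β n k * (1ℚ + ⟦ k ⟧ * h)) (β-suc k≤m) (harm-suc k≤m) ⟩
    q * β m k * β n k * (1ℚ + ⟦ k ⟧ * (harm m n k + x₁ + x₂))
      ≡⟨ simple-step q (β m k) (β n k) ⟦ k ⟧ (harm m n k) x₁ x₂ g q-harm ⟩
    q * (β m k * β n k * (1ℚ + ⟦ k ⟧ * harm m n k)) - g * (- ⟦ k ⟧ * (β m k * β n k))
      ≡⟨ cong₂ (λ s d → q * s - g * d) (simpleCoeff-≤ k≤n) (doubleCoeff-≤ k≤n) ⟨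
    q * simpleCoeff m n k - g * doubleCoeff m n k ∎
  out-of-range : ¬ k ≤ n → simpleCoeff (suc m) n k ≡ q * simpleCoeff m n k - g * doubleCoeff m n k
  out-of-range k≰n = begin
    simpleCoeff (suc m) n k
      ≡⟨ simpleCoeff-> k≰n ⟩
    sign (k ∸ n) * β (suc m) k * binom (n ℕ.+ k) k * inv (binom (k ∸ 1) n)
      ≡⟨ cong (λ b → sign (k ∸ n) * b * binom (n ℕ.+ k) k * inv (binom (k ∸ 1) n)) (β-suc k≤m) ⟩
    sign (k ∸ n) * (q * β m k) * binom (n ℕ.+ k) k * inv (binom (k ∸ 1) n)
      ≡⟨ pull q g (sign (k ∸ n)) (β m k) (binom (n ℕ.+ k) k) (inv (binom (k ∸ 1) n)) ⟩
    q * (sign (k ∸ n) * β m k * binom (n ℕ.+ k) k * inv (binom (k ∸ 1) n)) - g * 0ℚ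
      ≡⟨ cong₂ (λ s d → q * s - g * d) (simpleCoeff-> k≰n) (doubleCoeff-> k≰n) ⟨
    q * simpleCoeff m n k - g * doubleCoeff m n k ∎
    where
    pull : ∀ q g σ b b′ d → σ * (q * b) * b′ * d ≡ q * (σ * b * b′ * d) - g * 0ℚ
    pull q g σ b b′ d = solve (q ∷ g ∷ σ ∷ b ∷ b′ ∷ d ∷ []) ℚ-ring

doubleCoeff-sym : ∀ {m n k} → k ≤ m → k ≤ n → doubleCoeff m n k ≡ doubleCoeff n m k
doubleCoeff-sym {m} {n} {k} k≤m k≤n = begin
  doubleCoeff m n k            ≡⟨ doubleCoeff-≤ k≤n ⟩
  - ⟦ k ⟧ * (β m k * β n k)    ≡⟨ cong (- ⟦ k ⟧ *_) (ℚ.*-comm (β m k) (β n k)) ⟩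
  - ⟦ k ⟧ * (β n k * β m k)    ≡⟨ doubleCoeff-≤ k≤m ⟨
  doubleCoeff n m k            ∎

simpleCoeff-sym : ∀ {m n k} → k ≤ m → k ≤ n → simpleCoeff m n k ≡ simpleCoeff n m k
simpleCoeff-sym {m} {n} {k} k≤m k≤n = begin
  simpleCoeff m n k                                   ≡⟨ simpleCoeff-≤ k≤n ⟩
  β m k * β n k * (1ℚ + ⟦ k ⟧ * harm m n k)           ≡⟨ swap (β m k) (β n k) ⟦ k ⟧
                                                           (H 1 (m ℕ.+ k)) (H 1 (m ∸ k)) (H 1 (n ℕ.+ k)) (H 1 (n ∸ k)) (H 1 k) ⟩
  β n k * β m k * (1ℚ + ⟦ k ⟧ * harm n m k)           ≡⟨ simpleCoeff-≤ k≤m ⟨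
  simpleCoeff n m k                                   ∎
  where
  swap : ∀ b b′ K a₁ a₂ a₃ a₄ h → b * b′ * (1ℚ + K * (a₁ + a₂ + a₃ + a₄ - ⟦ 4 ⟧ * h))
                                 ≡ b′ * b * (1ℚ + K * (a₃ + a₄ + a₁ + a₂ - ⟦ 4 ⟧ * h))
  swap b b′ K a₁ a₂ a₃ a₄ h = solve (b ∷ b′ ∷ K ∷ a₁ ∷ a₂ ∷ a₃ ∷ a₄ ∷ h ∷ []) ℚ-ring

doubleCoeff-suc′ : ∀ {m n k} → k ≤ m → k ≤ n → doubleCoeff m (suc n) k ≡ ratioCoeff₂ (suc n) (doubleCoeff m n) k
doubleCoeff-suc′ {m} {n} {k} k≤m k≤n = begin
  doubleCoeff m (suc n) k                 ≡⟨ doubleCoeff-sym k≤m (ℕ.m≤n⇒m≤1+n k≤n) ⟩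
  doubleCoeff (suc n) m k                 ≡⟨ doubleCoeff-suc k≤n ⟩
  gain (suc n) k * doubleCoeff n m k      ≡⟨ cong (gain (suc n) k *_) (doubleCoeff-sym k≤n k≤m) ⟩
  gain (suc n) k * doubleCoeff m n k      ∎

simpleCoeff-suc′ : ∀ {m n k} → k ≤ m → k ≤ n →
  simpleCoeff m (suc n) k ≡ ratioCoeff₁ (suc n) (doubleCoeff m n) (simpleCoeff m n) k
simpleCoeff-suc′ {m} {n} {k} k≤m k≤n = begin
  simpleCoeff m (suc n) k                                   ≡⟨ simpleCoeff-sym k≤m (ℕ.m≤n⇒m≤1+n k≤n) ⟩
  simpleCoeff (suc n) m k                                   ≡⟨ simpleCoeff-suc k≤n ⟩
  ratioCoeff₁ (suc n) (doubleCoeff n m) (simpleCoeff n m) k ≡⟨ cong₂ (λ s d → gain (suc n) k * s - g * d)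
                                                                  (simpleCoeff-sym k≤n k≤m) (doubleCoeff-sym k≤n k≤m) ⟩
  ratioCoeff₁ (suc n) (doubleCoeff m n) (simpleCoeff m n) k ∎
  where
  g = ⟦ 2 ⟧ * ⟦ suc n ⟧ * (pole (- ⟦ suc n ⟧) k * pole (- ⟦ suc n ⟧) k)

new-pole-algebra : ∀ (M D iD ρn ρm σ σn σm V W B : ℚ) → D ≢ 0ℚ → iD * D ≡ 1ℚ →
  M * D * ρn ≡ σn * V → M * 1ℚ * ρm ≡ σm * W → B ≡ ⟦ 2 ⟧ * W → σ ≡ - (σn * σm) →
  σ * (B * 1ℚ) * V * iD ≡ ⟦ 2 ⟧ * M * (- M * ρn * ρm)
new-pole-algebra M D iD ρn ρm σ σn σm V W B D≢0 hD hn hm hB hσ = *-cancelʳ D≢0 (begin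
  σ * (B * 1ℚ) * V * iD * D                ≡⟨ solve (σ ∷ B ∷ V ∷ iD ∷ D ∷ []) ℚ-ring ⟩
  σ * B * V * (iD * D)                     ≡⟨ cong (σ * B * V *_) hD ⟩
  σ * B * V * 1ℚ                           ≡⟨ cong₂ (λ s b → s * b * V * 1ℚ) hσ hB ⟩
  - (σn * σm) * (⟦ 2 ⟧ * W) * V * 1ℚ       ≡⟨ solve (σn ∷ σm ∷ V ∷ W ∷ []) ℚ-ring ⟩
  - ⟦ 2 ⟧ * (σn * V) * (σm * W)            ≡⟨ cong₂ (λ a b → - ⟦ 2 ⟧ * a * b) hn hm ⟨
  - ⟦ 2 ⟧ * (M * D * ρn) * (M * 1ℚ * ρm)   ≡⟨ solve (M ∷ D ∷ ρn ∷ ρm ∷ []) ℚ-ring ⟩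
  ⟦ 2 ⟧ * M * (- M * ρn * ρm) * D          ∎)

simpleCoeff-new : ∀ {m n} → n ≤ m →
  simpleCoeff (suc m) n (suc m) ≡ ⟦ 2 ⟧ * ⟦ suc m ⟧ * (- ⟦ suc m ⟧ * R n (- ⟦ suc m ⟧) * R m (- ⟦ suc m ⟧))
simpleCoeff-new {m} {n} n≤m = begin
  simpleCoeff (suc m) n (suc m)
    ≡⟨ simpleCoeff-> {suc m} (ℕ.<⇒≱ (s≤s n≤m)) ⟩
  sign (suc m ∸ n) * (binom (suc m ℕ.+ suc m) (suc m) * binom (suc m) (suc m)) * binom (n ℕ.+ suc m) (suc m) * inv (binom m n)
    ≡⟨ cong₂ (λ c V → sign (suc m ∸ n) * (binom (suc m ℕ.+ suc m) (suc m) * c) * V * inv (binom m n))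
         (binom-diagonal (suc m)) (sym (binom-sym n (suc m))) ⟩
  sign (suc m ∸ n) * (binom (suc m ℕ.+ suc m) (suc m) * 1ℚ) * binom (n ℕ.+ suc m) n * inv (binom m n)
    ≡⟨ new-pole-algebra ⟦ suc m ⟧ (binom m n) (inv (binom m n)) (R n (- ⟦ suc m ⟧)) (R m (- ⟦ suc m ⟧))
         (sign (suc m ∸ n)) (sign (suc n)) (sign (suc m)) (binom (n ℕ.+ suc m) n) (binom (m ℕ.+ suc m) m)
         (binom (suc m ℕ.+ suc m) (suc m)) D≢0 (inv-inverseˡ D≢0) (R-at-pole {n} {suc m} (s≤s n≤m))
         (subst (λ c → ⟦ suc m ⟧ * c * R m (- ⟦ suc m ⟧) ≡ sign (suc m) * binom (m ℕ.+ suc m) m)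
           (binom-diagonal m) (R-at-pole {m} {suc m} ℕ.≤-refl))
         (central-binom m) (sign-∸ n≤m) ⟩
  ⟦ 2 ⟧ * ⟦ suc m ⟧ * (- ⟦ suc m ⟧ * R n (- ⟦ suc m ⟧) * R m (- ⟦ suc m ⟧)) ∎
  where
  D≢0 : binom m n ≢ 0ℚ
  D≢0 = subst (λ t → binom t n ≢ 0ℚ) (ℕ.m+[n∸m]≡n n≤m) (binom≢0 n (m ∸ n))

diag-double-algebra : ∀ (N ρ σ U B : ℚ) → N * 1ℚ * ρ ≡ σ * U → σ * σ ≡ 1ℚ → B ≡ ⟦ 2 ⟧ * U →
  - N * (B * 1ℚ * (B * 1ℚ)) ≡ ⟦ 2 ⟧ * N * (⟦ 2 ⟧ * N * (- N * ρ * ρ))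
diag-double-algebra N ρ σ U B hρ hσ hB = begin
  - N * (B * 1ℚ * (B * 1ℚ))                         ≡⟨ cong (λ b → - N * (b * 1ℚ * (b * 1ℚ))) hB ⟩
  - N * (⟦ 2 ⟧ * U * 1ℚ * (⟦ 2 ⟧ * U * 1ℚ))         ≡⟨ solve (N ∷ U ∷ []) ℚ-ring ⟩
  - ⟦ 4 ⟧ * N * (1ℚ * (U * U))                      ≡⟨ cong (λ w → - ⟦ 4 ⟧ * N * (w * (U * U))) (sym hσ) ⟩
  - ⟦ 4 ⟧ * N * (σ * σ * (U * U))                   ≡⟨ solve (N ∷ σ ∷ U ∷ []) ℚ-ring ⟩
  - ⟦ 4 ⟧ * N * ((σ * U) * (σ * U))                 ≡⟨ cong (λ w → - ⟦ 4 ⟧ * N * (w * w)) (sym hρ) ⟩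
  - ⟦ 4 ⟧ * N * ((N * 1ℚ * ρ) * (N * 1ℚ * ρ))       ≡⟨ solve (N ∷ ρ ∷ []) ℚ-ring ⟩
  ⟦ 2 ⟧ * N * (⟦ 2 ⟧ * N * (- N * ρ * ρ))           ∎

diag-simple-algebra : ∀ (N ρ ρ′ σ U B h H₂ iN i2N : ℚ) → N * 1ℚ * ρ ≡ σ * U → σ * σ ≡ 1ℚ → B ≡ ⟦ 2 ⟧ * U →
  ρ′ ≡ ρ * (iN + (h - 0ℚ) - (H₂ - (h + iN))) → iN * N ≡ 1ℚ → i2N * (N + N) ≡ 1ℚ →
  B * 1ℚ * (B * 1ℚ) * (1ℚ + N * ((H₂ + i2N) + 0ℚ + (H₂ + i2N) + 0ℚ - ⟦ 4 ⟧ * (h + iN)))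
    ≡ ⟦ 2 ⟧ * N * ((ρ * ρ + ⟦ 2 ⟧ * - N * ρ * ρ′) * (⟦ 2 ⟧ * N) - - N * ρ * ρ) - ⟦ 2 ⟧ * N * (- N * ρ * ρ)
diag-simple-algebra N ρ ρ′ σ U B h H₂ iN i2N hρ hσ hB hρ′ hN h2N = trans lhs (sym rhs)
  where
  lhs : B * 1ℚ * (B * 1ℚ) * (1ℚ + N * ((H₂ + i2N) + 0ℚ + (H₂ + i2N) + 0ℚ - ⟦ 4 ⟧ * (h + iN)))
        ≡ ⟦ 8 ⟧ * ((N * 1ℚ * ρ) * (N * 1ℚ * ρ)) * (N * H₂ - ⟦ 2 ⟧ * N * h - 1ℚ)
  lhs = begin
    B * 1ℚ * (B * 1ℚ) * (1ℚ + N * ((H₂ + i2N) + 0ℚ + (H₂ + i2N) + 0ℚ - ⟦ 4 ⟧ * (h + iN)))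
      ≡⟨ cong (λ b → b * 1ℚ * (b * 1ℚ) * (1ℚ + N * ((H₂ + i2N) + 0ℚ + (H₂ + i2N) + 0ℚ - ⟦ 4 ⟧ * (h + iN)))) hB ⟩
    ⟦ 2 ⟧ * U * 1ℚ * (⟦ 2 ⟧ * U * 1ℚ) * (1ℚ + N * ((H₂ + i2N) + 0ℚ + (H₂ + i2N) + 0ℚ - ⟦ 4 ⟧ * (h + iN)))
      ≡⟨ solve (N ∷ U ∷ h ∷ H₂ ∷ iN ∷ i2N ∷ []) ℚ-ring ⟩
    ⟦ 4 ⟧ * (U * U) * (1ℚ + ⟦ 2 ⟧ * N * H₂ - ⟦ 4 ⟧ * N * h + i2N * (N + N) - ⟦ 4 ⟧ * (iN * N))
      ≡⟨ cong₂ (λ a b → ⟦ 4 ⟧ * (U * U) * (1ℚ + ⟦ 2 ⟧ * N * H₂ - ⟦ 4 ⟧ * N * h + a - ⟦ 4 ⟧ * b)) h2N hN ⟩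
    ⟦ 4 ⟧ * (U * U) * (1ℚ + ⟦ 2 ⟧ * N * H₂ - ⟦ 4 ⟧ * N * h + 1ℚ - ⟦ 4 ⟧ * 1ℚ)
      ≡⟨ solve (N ∷ U ∷ h ∷ H₂ ∷ []) ℚ-ring ⟩
    ⟦ 8 ⟧ * (1ℚ * (U * U)) * (N * H₂ - ⟦ 2 ⟧ * N * h - 1ℚ)
      ≡⟨ cong (λ w → ⟦ 8 ⟧ * (w * (U * U)) * (N * H₂ - ⟦ 2 ⟧ * N * h - 1ℚ)) (sym hσ) ⟩
    ⟦ 8 ⟧ * (σ * σ * (U * U)) * (N * H₂ - ⟦ 2 ⟧ * N * h - 1ℚ)
      ≡⟨ cong (λ w → ⟦ 8 ⟧ * w * (N * H₂ - ⟦ 2 ⟧ * N * h - 1ℚ)) (square-product σ U) ⟩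
    ⟦ 8 ⟧ * ((σ * U) * (σ * U)) * (N * H₂ - ⟦ 2 ⟧ * N * h - 1ℚ)
      ≡⟨ cong (λ w → ⟦ 8 ⟧ * (w * w) * (N * H₂ - ⟦ 2 ⟧ * N * h - 1ℚ)) (sym hρ) ⟩
    ⟦ 8 ⟧ * ((N * 1ℚ * ρ) * (N * 1ℚ * ρ)) * (N * H₂ - ⟦ 2 ⟧ * N * h - 1ℚ) ∎
    where
    square-product : ∀ a b → a * a * (b * b) ≡ (a * b) * (a * b)
    square-product a b = solve (a ∷ b ∷ []) ℚ-ring
  rhs : ⟦ 2 ⟧ * N * ((ρ * ρ + ⟦ 2 ⟧ * - N * ρ * ρ′) * (⟦ 2 ⟧ * N) - - N * ρ * ρ) - ⟦ 2 ⟧ * N * (- N * ρ * ρ)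
        ≡ ⟦ 8 ⟧ * ((N * 1ℚ * ρ) * (N * 1ℚ * ρ)) * (N * H₂ - ⟦ 2 ⟧ * N * h - 1ℚ)
  rhs = begin
    ⟦ 2 ⟧ * N * ((ρ * ρ + ⟦ 2 ⟧ * - N * ρ * ρ′) * (⟦ 2 ⟧ * N) - - N * ρ * ρ) - ⟦ 2 ⟧ * N * (- N * ρ * ρ)
      ≡⟨ cong (λ r → ⟦ 2 ⟧ * N * ((ρ * ρ + ⟦ 2 ⟧ * - N * ρ * r) * (⟦ 2 ⟧ * N) - - N * ρ * ρ)
                     - ⟦ 2 ⟧ * N * (- N * ρ * ρ)) hρ′ ⟩
    ⟦ 2 ⟧ * N * ((ρ * ρ + ⟦ 2 ⟧ * - N * ρ * (ρ * (iN + (h - 0ℚ) - (H₂ - (h + iN))))) * (⟦ 2 ⟧ * N) - - N * ρ * ρ)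
      - ⟦ 2 ⟧ * N * (- N * ρ * ρ)
      ≡⟨ solve (N ∷ ρ ∷ h ∷ H₂ ∷ iN ∷ []) ℚ-ring ⟩
    ⟦ 8 ⟧ * ((N * 1ℚ * ρ) * (N * 1ℚ * ρ)) * (N * H₂ - ⟦ 2 ⟧ * N * h + 1ℚ - ⟦ 2 ⟧ * (iN * N))
      ≡⟨ cong (λ w → ⟦ 8 ⟧ * ((N * 1ℚ * ρ) * (N * 1ℚ * ρ)) * (N * H₂ - ⟦ 2 ⟧ * N * h + 1ℚ - ⟦ 2 ⟧ * w)) hN ⟩
    ⟦ 8 ⟧ * ((N * 1ℚ * ρ) * (N * 1ℚ * ρ)) * (N * H₂ - ⟦ 2 ⟧ * N * h + 1ℚ - ⟦ 2 ⟧ * 1ℚ)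
      ≡⟨ cong (⟦ 8 ⟧ * ((N * 1ℚ * ρ) * (N * 1ℚ * ρ)) *_) (tidy N H₂ h) ⟩
    ⟦ 8 ⟧ * ((N * 1ℚ * ρ) * (N * 1ℚ * ρ)) * (N * H₂ - ⟦ 2 ⟧ * N * h - 1ℚ) ∎
    where
    tidy : ∀ N H₂ h → N * H₂ - ⟦ 2 ⟧ * N * h + 1ℚ - ⟦ 2 ⟧ * 1ℚ ≡ N * H₂ - ⟦ 2 ⟧ * N * h - 1ℚ
    tidy N H₂ h = solve (N ∷ H₂ ∷ h ∷ []) ℚ-ring

-- Expansions of y R n y R m y

expansion : ℕ → ℕ → ℕ → ℚ → ℚ
expansion m n K = pf K (doubleCoeff m n) (simpleCoeff m n)

expansion′ : ℕ → ℕ → ℕ → ℚ → ℚ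
expansion′ m n K = pf′ K (doubleCoeff m n) (simpleCoeff m n)

raise-m : ∀ {m n K} y → K ≤ m → Regular K y → y + ⟦ suc m ⟧ ≢ 0ℚ →
  expansion m n K y * ratio (suc m) y
    ≡ expansion (suc m) n K y + expansion m n K (- ⟦ suc m ⟧) * (⟦ 2 ⟧ * ⟦ suc m ⟧ * pole y (suc m))
raise-m {m} {n} {K} y K≤m y-reg y+M≢0 = trans (pf-ratio (doubleCoeff m n) (simpleCoeff m n) y (s≤s K≤m) y-reg y+M≢0)
  (cong (_+ expansion m n K (- ⟦ suc m ⟧) * (⟦ 2 ⟧ * ⟦ suc m ⟧ * pole y (suc m)))
    (sym (pf-cong K y (λ k k≤K → doubleCoeff-suc (ℕ.≤-trans k≤K K≤m)) (λ k k≤K → simpleCoeff-suc (ℕ.≤-trans k≤K K≤m)))))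

raise-m′ : ∀ {m n K} y → K ≤ m → Regular K y → y + ⟦ suc m ⟧ ≢ 0ℚ →
  expansion′ m n K y * ratio (suc m) y + expansion m n K y * ratio′ (suc m) y
    ≡ expansion′ (suc m) n K y + expansion m n K (- ⟦ suc m ⟧) * ratio′ (suc m) y
raise-m′ {m} {n} {K} y K≤m y-reg y+M≢0 = trans (pf-ratio′ (doubleCoeff m n) (simpleCoeff m n) y (s≤s K≤m) y-reg y+M≢0)
  (cong (_+ expansion m n K (- ⟦ suc m ⟧) * ratio′ (suc m) y)
    (sym (pf′-cong K y (λ k k≤K → doubleCoeff-suc (ℕ.≤-trans k≤K K≤m)) (λ k k≤K → simpleCoeff-suc (ℕ.≤-trans k≤K K≤m)))))

raise-m-at-pole : ∀ {m n K} → K ≤ m →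
  expansion (suc m) n K (- ⟦ suc m ⟧) + expansion m n K (- ⟦ suc m ⟧) ≡ expansion′ m n K (- ⟦ suc m ⟧) * (⟦ 2 ⟧ * ⟦ suc m ⟧)
raise-m-at-pole {m} {n} {K} K≤m = trans
  (cong (_+ expansion m n K (- ⟦ suc m ⟧))
    (pf-cong K (- ⟦ suc m ⟧) (λ k k≤K → doubleCoeff-suc (ℕ.≤-trans k≤K K≤m)) (λ k k≤K → simpleCoeff-suc (ℕ.≤-trans k≤K K≤m))))
  (pf-ratio-at-pole K (suc m) (doubleCoeff m n) (simpleCoeff m n))

raise-n : ∀ {m n K} y → K ≤ m → K ≤ n → Regular K y → y + ⟦ suc n ⟧ ≢ 0ℚ →
  expansion m n K y * ratio (suc n) y
    ≡ expansion m (suc n) K y + expansion m n K (- ⟦ suc n ⟧) * (⟦ 2 ⟧ * ⟦ suc n ⟧ * pole y (suc n))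
raise-n {m} {n} {K} y K≤m K≤n y-reg y+N≢0 = trans (pf-ratio (doubleCoeff m n) (simpleCoeff m n) y (s≤s K≤n) y-reg y+N≢0)
  (cong (_+ expansion m n K (- ⟦ suc n ⟧) * (⟦ 2 ⟧ * ⟦ suc n ⟧ * pole y (suc n)))
    (sym (pf-cong K y (λ k k≤K → doubleCoeff-suc′ (ℕ.≤-trans k≤K K≤m) (ℕ.≤-trans k≤K K≤n))
                      (λ k k≤K → simpleCoeff-suc′ (ℕ.≤-trans k≤K K≤m) (ℕ.≤-trans k≤K K≤n)))))

raise-n′ : ∀ {m n K} y → K ≤ m → K ≤ n → Regular K y → y + ⟦ suc n ⟧ ≢ 0ℚ →
  expansion′ m n K y * ratio (suc n) y + expansion m n K y * ratio′ (suc n) y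
    ≡ expansion′ m (suc n) K y + expansion m n K (- ⟦ suc n ⟧) * ratio′ (suc n) y
raise-n′ {m} {n} {K} y K≤m K≤n y-reg y+N≢0 = trans (pf-ratio′ (doubleCoeff m n) (simpleCoeff m n) y (s≤s K≤n) y-reg y+N≢0)
  (cong (_+ expansion m n K (- ⟦ suc n ⟧) * ratio′ (suc n) y)
    (sym (pf′-cong K y (λ k k≤K → doubleCoeff-suc′ (ℕ.≤-trans k≤K K≤m) (ℕ.≤-trans k≤K K≤n))
                       (λ k k≤K → simpleCoeff-suc′ (ℕ.≤-trans k≤K K≤m) (ℕ.≤-trans k≤K K≤n)))))

double-step-value : ∀ (N v r S S₁ S₂ s s₁ A B : ℚ) → r ≡ ⟦ 2 ⟧ * N * v - 1ℚ →
  S * r ≡ S₁ + s * (⟦ 2 ⟧ * N * v) → S₁ * r ≡ S₂ + s₁ * (⟦ 2 ⟧ * N * v) →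
  A ≡ ⟦ 2 ⟧ * N * (⟦ 2 ⟧ * N * s) → B ≡ ⟦ 2 ⟧ * N * s₁ - ⟦ 2 ⟧ * N * s →
  S₂ + (A * (v * v) + B * v) ≡ S * r * r
double-step-value N v r S S₁ S₂ s s₁ A B hr h₁ h₂ hA hB = sym (begin
  S * r * r                                                ≡⟨ cong (_* r) h₁ ⟩
  (S₁ + s * (⟦ 2 ⟧ * N * v)) * r                           ≡⟨ solve (N ∷ v ∷ r ∷ S₁ ∷ s ∷ []) ℚ-ring ⟩
  S₁ * r + s * (⟦ 2 ⟧ * N * v) * r                         ≡⟨ cong (_+ s * (⟦ 2 ⟧ * N * v) * r) h₂ ⟩
  S₂ + s₁ * (⟦ 2 ⟧ * N * v) + s * (⟦ 2 ⟧ * N * v) * r       ≡⟨ cong (λ w → S₂ + s₁ * (⟦ 2 ⟧ * N * v)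
                                                                           + s * (⟦ 2 ⟧ * N * v) * w) hr ⟩
  S₂ + s₁ * (⟦ 2 ⟧ * N * v) + s * (⟦ 2 ⟧ * N * v) * (⟦ 2 ⟧ * N * v - 1ℚ)
                                                           ≡⟨ solve (N ∷ v ∷ S₂ ∷ s ∷ s₁ ∷ []) ℚ-ring ⟩
  S₂ + (⟦ 2 ⟧ * N * (⟦ 2 ⟧ * N * s) * (v * v) + (⟦ 2 ⟧ * N * s₁ - ⟦ 2 ⟧ * N * s) * v)
                                                           ≡⟨ cong₂ (λ a b → S₂ + (a * (v * v) + b * v)) hA hB ⟨
  S₂ + (A * (v * v) + B * v)                               ∎)

double-step-derivative : ∀ (N v r r′ S S′ S₁ S₁′ S₂′ s s₁ A B : ℚ) →
  r ≡ ⟦ 2 ⟧ * N * v - 1ℚ → r′ ≡ - (⟦ 2 ⟧ * N * (v * v)) → S * r ≡ S₁ + s * (⟦ 2 ⟧ * N * v) →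
  S′ * r + S * r′ ≡ S₁′ + s * r′ → S₁′ * r + S₁ * r′ ≡ S₂′ + s₁ * r′ →
  A ≡ ⟦ 2 ⟧ * N * (⟦ 2 ⟧ * N * s) → B ≡ ⟦ 2 ⟧ * N * s₁ - ⟦ 2 ⟧ * N * s →
  S₂′ + (- (⟦ 2 ⟧ * A * (v * v * v)) - B * (v * v)) ≡ S′ * r * r + ⟦ 2 ⟧ * S * r * r′
double-step-derivative N v r r′ S S′ S₁ S₁′ S₂′ s s₁ A B hr hr′ h₁ h₁′ h₂′ hA hB = sym (begin
  S′ * r * r + ⟦ 2 ⟧ * S * r * r′                          ≡⟨ solve (S ∷ S′ ∷ r ∷ r′ ∷ []) ℚ-ring ⟩
  (S′ * r + S * r′) * r + (S * r) * r′                     ≡⟨ cong₂ (λ a b → a * r + b * r′) h₁′ h₁ ⟩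
  (S₁′ + s * r′) * r + (S₁ + s * (⟦ 2 ⟧ * N * v)) * r′     ≡⟨ solve (S₁ ∷ S₁′ ∷ s ∷ N ∷ v ∷ r ∷ r′ ∷ []) ℚ-ring ⟩
  (S₁′ * r + S₁ * r′) + s * r′ * r + s * (⟦ 2 ⟧ * N * v) * r′
                                                           ≡⟨ cong (λ a → a + s * r′ * r + s * (⟦ 2 ⟧ * N * v) * r′) h₂′ ⟩
  S₂′ + s₁ * r′ + s * r′ * r + s * (⟦ 2 ⟧ * N * v) * r′    ≡⟨ cong₂ (λ a b → S₂′ + s₁ * b + s * b * a
                                                                             + s * (⟦ 2 ⟧ * N * v) * b) hr hr′ ⟩
  S₂′ + s₁ * - (⟦ 2 ⟧ * N * (v * v)) + s * - (⟦ 2 ⟧ * N * (v * v)) * (⟦ 2 ⟧ * N * v - 1ℚ)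
    + s * (⟦ 2 ⟧ * N * v) * - (⟦ 2 ⟧ * N * (v * v))        ≡⟨ solve (S₂′ ∷ s ∷ s₁ ∷ N ∷ v ∷ []) ℚ-ring ⟩
  S₂′ + (- (⟦ 2 ⟧ * (⟦ 2 ⟧ * N * (⟦ 2 ⟧ * N * s)) * (v * v * v)) - (⟦ 2 ⟧ * N * s₁ - ⟦ 2 ⟧ * N * s) * (v * v))
                                                           ≡⟨ cong₂ (λ a b → S₂′ + (- (⟦ 2 ⟧ * a * (v * v * v))
                                                                                      - b * (v * v))) hA hB ⟨
  S₂′ + (- (⟦ 2 ⟧ * A * (v * v * v)) - B * (v * v))        ∎)

base-value : ∀ (y u : ℚ) → u * (y + 0ℚ) ≡ 1ℚ → 0ℚ + (0ℚ * (u * u) + 1ℚ * u) ≡ y * u * u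
base-value y u hu = begin
  0ℚ + (0ℚ * (u * u) + 1ℚ * u)   ≡⟨ solve (u ∷ []) ℚ-ring ⟩
  u * 1ℚ                         ≡⟨ cong (u *_) (sym hu) ⟩
  u * (u * (y + 0ℚ))             ≡⟨ solve (y ∷ u ∷ []) ℚ-ring ⟩
  y * u * u                      ∎

base-derivative : ∀ (y u : ℚ) → u * (y + 0ℚ) ≡ 1ℚ →
  0ℚ + (- (⟦ 2 ⟧ * 0ℚ * (u * u * u)) - 1ℚ * (u * u)) ≡ u * u + ⟦ 2 ⟧ * y * u * - (u * u)
base-derivative y u hu = begin
  0ℚ + (- (⟦ 2 ⟧ * 0ℚ * (u * u * u)) - 1ℚ * (u * u))  ≡⟨ solve (u ∷ []) ℚ-ring ⟩
  u * u - ⟦ 2 ⟧ * (u * u) * 1ℚ                        ≡⟨ cong (λ w → u * u - ⟦ 2 ⟧ * (u * u) * w) (sym hu) ⟩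
  u * u - ⟦ 2 ⟧ * (u * u) * (u * (y + 0ℚ))            ≡⟨ solve (y ∷ u ∷ []) ℚ-ring ⟩
  u * u + ⟦ 2 ⟧ * y * u * - (u * u)                   ∎

module Diagonal (n : ℕ) where
  N = suc n
  ρ = R n (- ⟦ N ⟧)
  ρ′ = R′ n (- ⟦ N ⟧)
  U = binom (n ℕ.+ N) n
  B = binom (N ℕ.+ N) N

  Nρ : ⟦ N ⟧ * 1ℚ * ρ ≡ sign N * U
  Nρ = subst (λ c → ⟦ N ⟧ * c * ρ ≡ sign N * U) (binom-diagonal n) (R-at-pole {n} {N} ℕ.≤-refl)

  ρ′≡ : ρ′ ≡ ρ * (inv ⟦ N ⟧ + (H 1 n - 0ℚ) - (H 1 (N ℕ.+ n) - (H 1 n + inv ⟦ N ⟧)))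
  ρ′≡ = trans (R′-at-pole {n} {N} ℕ.≤-refl)
    (cong₂ (λ h₀ h → ρ * (inv ⟦ N ⟧ + (H 1 n - h₀) - (H 1 (N ℕ.+ n) - h))) (cong (H 1) (ℕ.n∸n≡0 n)) (H-suc n))

  doubleCoeff-diag : doubleCoeff N N N ≡ ⟦ 2 ⟧ * ⟦ N ⟧ * (⟦ 2 ⟧ * ⟦ N ⟧ * (- ⟦ N ⟧ * ρ * ρ))
  doubleCoeff-diag = begin
    doubleCoeff N N N                             ≡⟨ doubleCoeff-≤ {N} {N} ℕ.≤-refl ⟩
    - ⟦ N ⟧ * (B * binom N N * (B * binom N N))   ≡⟨ cong (λ c → - ⟦ N ⟧ * (B * c * (B * c))) (binom-diagonal N) ⟩
    - ⟦ N ⟧ * (B * 1ℚ * (B * 1ℚ))                 ≡⟨ diag-double-algebra ⟦ N ⟧ ρ (sign N) U B Nρ (sign-square N)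
                                                                         (central-binom n) ⟩
    ⟦ 2 ⟧ * ⟦ N ⟧ * (⟦ 2 ⟧ * ⟦ N ⟧ * (- ⟦ N ⟧ * ρ * ρ)) ∎

  simpleCoeff-diag : simpleCoeff N N N
    ≡ ⟦ 2 ⟧ * ⟦ N ⟧ * ((ρ * ρ + ⟦ 2 ⟧ * - ⟦ N ⟧ * ρ * ρ′) * (⟦ 2 ⟧ * ⟦ N ⟧) - - ⟦ N ⟧ * ρ * ρ)
      - ⟦ 2 ⟧ * ⟦ N ⟧ * (- ⟦ N ⟧ * ρ * ρ)
  simpleCoeff-diag = begin
    simpleCoeff N N N
      ≡⟨ simpleCoeff-≤ {N} {N} ℕ.≤-refl ⟩
    B * binom N N * (B * binom N N) * (1ℚ + ⟦ N ⟧ * harm N N N)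
      ≡⟨ cong₂ (λ c h → B * c * (B * c) * (1ℚ + ⟦ N ⟧ * h)) (binom-diagonal N) harm-diag ⟩
    B * 1ℚ * (B * 1ℚ)
      * (1ℚ + ⟦ N ⟧ * ((H 1 (N ℕ.+ n) + i2N) + 0ℚ + (H 1 (N ℕ.+ n) + i2N) + 0ℚ - ⟦ 4 ⟧ * (H 1 n + inv ⟦ N ⟧)))
      ≡⟨ diag-simple-algebra ⟦ N ⟧ ρ ρ′ (sign N) U B (H 1 n) (H 1 (N ℕ.+ n)) (inv ⟦ N ⟧) i2N
           Nρ (sign-square N) (central-binom n) ρ′≡ (inv-inverseˡ (⟦suc⟧≢0 n))
           (subst (λ t → i2N * t ≡ 1ℚ) (⟦⟧-homo-+′ N N (sym (ℕ.+-suc N n))) (inv-inverseˡ (⟦suc⟧≢0 (N ℕ.+ n)))) ⟩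
    ⟦ 2 ⟧ * ⟦ N ⟧ * ((ρ * ρ + ⟦ 2 ⟧ * - ⟦ N ⟧ * ρ * ρ′) * (⟦ 2 ⟧ * ⟦ N ⟧) - - ⟦ N ⟧ * ρ * ρ)
      - ⟦ 2 ⟧ * ⟦ N ⟧ * (- ⟦ N ⟧ * ρ * ρ) ∎
    where
    i2N = inv ⟦ suc (N ℕ.+ n) ⟧
    H[N+N] : H 1 (N ℕ.+ N) ≡ H 1 (N ℕ.+ n) + i2N
    H[N+N] = trans (cong (H 1) (ℕ.+-suc N n)) (H-suc (N ℕ.+ n))
    H[N∸N] : H 1 (N ∸ N) ≡ 0ℚ
    H[N∸N] = cong (H 1) (ℕ.n∸n≡0 N)
    harm-diag : harm N N N ≡ (H 1 (N ℕ.+ n) + i2N) + 0ℚ + (H 1 (N ℕ.+ n) + i2N) + 0ℚ - ⟦ 4 ⟧ * (H 1 n + inv ⟦ N ⟧)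
    harm-diag = trans (cong₂ (λ a b → a + b + a + b - ⟦ 4 ⟧ * H 1 N) H[N+N] H[N∸N])
      (cong (λ c → (H 1 (N ℕ.+ n) + i2N) + 0ℚ + (H 1 (N ℕ.+ n) + i2N) + 0ℚ - ⟦ 4 ⟧ * c) (H-suc n))

  new-double : expansion n n n (- ⟦ N ⟧) ≡ - ⟦ N ⟧ * ρ * ρ →
    doubleCoeff N N N ≡ ⟦ 2 ⟧ * ⟦ N ⟧ * (⟦ 2 ⟧ * ⟦ N ⟧ * expansion n n n (- ⟦ N ⟧))
  new-double value = trans doubleCoeff-diag (cong (λ s → ⟦ 2 ⟧ * ⟦ N ⟧ * (⟦ 2 ⟧ * ⟦ N ⟧ * s)) (sym value))

  new-simple : expansion n n n (- ⟦ N ⟧) ≡ - ⟦ N ⟧ * ρ * ρ →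
    expansion′ n n n (- ⟦ N ⟧) ≡ ρ * ρ + ⟦ 2 ⟧ * - ⟦ N ⟧ * ρ * ρ′ →
    simpleCoeff N N N ≡ ⟦ 2 ⟧ * ⟦ N ⟧ * expansion N n n (- ⟦ N ⟧) - ⟦ 2 ⟧ * ⟦ N ⟧ * expansion n n n (- ⟦ N ⟧)
  new-simple value derivative = begin
    simpleCoeff N N N
      ≡⟨ simpleCoeff-diag ⟩
    ⟦ 2 ⟧ * ⟦ N ⟧ * ((ρ * ρ + ⟦ 2 ⟧ * - ⟦ N ⟧ * ρ * ρ′) * (⟦ 2 ⟧ * ⟦ N ⟧) - - ⟦ N ⟧ * ρ * ρ)
      - ⟦ 2 ⟧ * ⟦ N ⟧ * (- ⟦ N ⟧ * ρ * ρ)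
      ≡⟨ cong₂ (λ s′ s → ⟦ 2 ⟧ * ⟦ N ⟧ * (s′ * (⟦ 2 ⟧ * ⟦ N ⟧) - s) - ⟦ 2 ⟧ * ⟦ N ⟧ * s) derivative value ⟨
    ⟦ 2 ⟧ * ⟦ N ⟧ * (S′ * (⟦ 2 ⟧ * ⟦ N ⟧) - S) - ⟦ 2 ⟧ * ⟦ N ⟧ * S
      ≡⟨ cong (λ s₁ → ⟦ 2 ⟧ * ⟦ N ⟧ * s₁ - ⟦ 2 ⟧ * ⟦ N ⟧ * S) (sym S₁-at-pole) ⟩
    ⟦ 2 ⟧ * ⟦ N ⟧ * expansion N n n (- ⟦ N ⟧) - ⟦ 2 ⟧ * ⟦ N ⟧ * S ∎
    where
    S = expansion n n n (- ⟦ N ⟧)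
    S′ = expansion′ n n n (- ⟦ N ⟧)
    S₁-at-pole : expansion N n n (- ⟦ N ⟧) ≡ S′ * (⟦ 2 ⟧ * ⟦ N ⟧) - S
    S₁-at-pole = subtract (raise-m-at-pole {n} {n} ℕ.≤-refl)
      where
      subtract : ∀ {a b c} → a + b ≡ c → a ≡ c - b
      subtract {a} {b} eq = trans (cancel a b) (cong (_- b) eq)
        where
        cancel : ∀ a b → a ≡ a + b - b
        cancel a b = solve (a ∷ b ∷ []) ℚ-ring

diagonal : ∀ n y → Regular n y →
  expansion n n n y ≡ y * R n y * R n y × expansion′ n n n y ≡ R n y * R n y + ⟦ 2 ⟧ * y * R n y * R′ n y
diagonal zero    y y-reg = base-value y (pole y 0) u-inverse , base-derivative y (pole y 0) u-inverse
  where
  u-inverse = inv-inverseˡ (y-reg 0 z≤n)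
diagonal (suc n) y y-reg = value , derivative
  where
  N = suc n
  y-reg′ : Regular n y
  y-reg′ = Regular-≤ {y = y} (ℕ.n≤1+n n) y-reg
  y+N≢0 = y-reg N ℕ.≤-refl
  IH = diagonal n y y-reg′
  IH₋ = diagonal n (- ⟦ N ⟧) (Regular-pole {n} {N} ℕ.≤-refl)
  v = pole y N
  r = ratio N y
  r′ = ratio′ N y
  S S′ S₁ S₁′ S₂ S₂′ : ℚ → ℚ
  S   = expansion n n n
  S′  = expansion′ n n n
  S₁  = expansion N n n
  S₁′ = expansion′ N n n
  S₂  = expansion N N n
  S₂′ = expansion′ N N n

  new-double = Diagonal.new-double n (proj₁ IH₋)
  new-simple = Diagonal.new-simple n (proj₁ IH₋) (proj₂ IH₋)

  value : expansion N N N y ≡ y * R N y * R N y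
  value = begin
    expansion N N N y
      ≡⟨ double-step-value ⟦ N ⟧ v r (S y) (S₁ y) (S₂ y) (S (- ⟦ N ⟧)) (S₁ (- ⟦ N ⟧)) _ _ refl
           (raise-m y ℕ.≤-refl y-reg′ y+N≢0) (raise-n y (ℕ.n≤1+n n) ℕ.≤-refl y-reg′ y+N≢0) new-double new-simple ⟩
    S y * r * r
      ≡⟨ cong (λ w → w * r * r) (proj₁ IH) ⟩
    y * R n y * R n y * r * r
      ≡⟨ regroup y (R n y) r ⟩
    y * R N y * R N y ∎
    where
    regroup : ∀ y ρ r → y * ρ * ρ * r * r ≡ y * (ρ * r) * (ρ * r)
    regroup y ρ r = solve (y ∷ ρ ∷ r ∷ []) ℚ-ring

  derivative : expansion′ N N N y ≡ R N y * R N y + ⟦ 2 ⟧ * y * R N y * R′ N y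
  derivative = begin
    expansion′ N N N y
      ≡⟨ double-step-derivative ⟦ N ⟧ v r r′ (S y) (S′ y) (S₁ y) (S₁′ y) (S₂′ y) (S (- ⟦ N ⟧)) (S₁ (- ⟦ N ⟧)) _ _
           refl refl (raise-m y ℕ.≤-refl y-reg′ y+N≢0) (raise-m′ y ℕ.≤-refl y-reg′ y+N≢0)
           (raise-n′ y (ℕ.n≤1+n n) ℕ.≤-refl y-reg′ y+N≢0) new-double new-simple ⟩
    S′ y * r * r + ⟦ 2 ⟧ * S y * r * r′
      ≡⟨ cong₂ (λ a b → a * r * r + ⟦ 2 ⟧ * b * r * r′) (proj₂ IH) (proj₁ IH) ⟩
    (R n y * R n y + ⟦ 2 ⟧ * y * R n y * R′ n y) * r * r + ⟦ 2 ⟧ * (y * R n y * R n y) * r * r′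
      ≡⟨ product-rule y (R n y) (R′ n y) r r′ ⟩
    R N y * R N y + ⟦ 2 ⟧ * y * R N y * R′ N y ∎
    where
    product-rule : ∀ y ρ ρ′ r r′ → (ρ * ρ + ⟦ 2 ⟧ * y * ρ * ρ′) * r * r + ⟦ 2 ⟧ * (y * ρ * ρ) * r * r′
                                   ≡ ρ * r * (ρ * r) + ⟦ 2 ⟧ * y * (ρ * r) * (ρ′ * r + ρ * r′)
    product-rule y ρ ρ′ r r′ = solve (y ∷ ρ ∷ ρ′ ∷ r ∷ r′ ∷ []) ℚ-ring

simple-pole-term : ∀ (a b s M v : ℚ) → a ≡ 0ℚ → b ≡ ⟦ 2 ⟧ * M * s → a * (v * v) + b * v ≡ s * (⟦ 2 ⟧ * M * v)
simple-pole-term a b s M v refl refl = solve (s ∷ M ∷ v ∷ []) ℚ-ring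

off-diagonal : ∀ {n m} → n ≤′ m → ∀ y → Regular m y → expansion m n m y ≡ y * R n y * R m y
off-diagonal {n} ≤′-refl y y-reg = proj₁ (diagonal n y y-reg)
off-diagonal {n} (≤′-step {m} n≤′m) y y-reg = begin
  expansion M n m y + (doubleCoeff M n M * (v * v) + simpleCoeff M n M * v)
    ≡⟨ cong (expansion M n m y +_)
         (simple-pole-term _ _ (expansion m n m (- ⟦ M ⟧)) ⟦ M ⟧ v (doubleCoeff-> {M} (ℕ.<⇒≱ (s≤s n≤m))) new-simple) ⟩
  expansion M n m y + expansion m n m (- ⟦ M ⟧) * (⟦ 2 ⟧ * ⟦ M ⟧ * v)
    ≡⟨ raise-m y ℕ.≤-refl y-reg′ (y-reg M ℕ.≤-refl) ⟨
  expansion m n m y * ratio M y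
    ≡⟨ cong (_* ratio M y) (off-diagonal n≤′m y y-reg′) ⟩
  y * R n y * R m y * ratio M y
    ≡⟨ ℚ.*-assoc (y * R n y) (R m y) (ratio M y) ⟩
  y * R n y * R M y ∎
  where
  M = suc m
  n≤m = ℕ.≤′⇒≤ n≤′m
  v = pole y M
  y-reg′ : Regular m y
  y-reg′ = Regular-≤ {y = y} (ℕ.n≤1+n m) y-reg
  new-simple : simpleCoeff M n M ≡ ⟦ 2 ⟧ * ⟦ M ⟧ * expansion m n m (- ⟦ M ⟧)
  new-simple = trans (simpleCoeff-new n≤m)
    (cong (⟦ 2 ⟧ * ⟦ M ⟧ *_) (sym (off-diagonal n≤′m (- ⟦ M ⟧) (Regular-pole {m} {M} ℕ.≤-refl))))

first-sum-term : ∀ {m n k} x → x + ⟦ k ⟧ ≢ 0ℚ → k ≤ n →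
  binom (m ℕ.+ k) k * binom m k * binom (n ℕ.+ k) k * binom n k
    * ((- ⟦ k ⟧) * inv ((x + ⟦ k ⟧) * (x + ⟦ k ⟧)) + (1ℚ + ⟦ k ⟧ * harm m n k) * inv (x + ⟦ k ⟧))
  ≡ pfTerm (doubleCoeff m n) (simpleCoeff m n) x k
first-sum-term {m} {n} {k} x x+k≢0 k≤n = begin
  binom (m ℕ.+ k) k * binom m k * binom (n ℕ.+ k) k * binom n k
    * ((- ⟦ k ⟧) * inv ((x + ⟦ k ⟧) * (x + ⟦ k ⟧)) + (1ℚ + ⟦ k ⟧ * harm m n k) * inv (x + ⟦ k ⟧))
    ≡⟨ cong (λ w → binom (m ℕ.+ k) k * binom m k * binom (n ℕ.+ k) k * binom n k
                     * ((- ⟦ k ⟧) * w + (1ℚ + ⟦ k ⟧ * harm m n k) * inv (x + ⟦ k ⟧)))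
            (inv-distrib-* x+k≢0 x+k≢0) ⟩
  binom (m ℕ.+ k) k * binom m k * binom (n ℕ.+ k) k * binom n k
    * ((- ⟦ k ⟧) * (pole x k * pole x k) + (1ℚ + ⟦ k ⟧ * harm m n k) * pole x k)
    ≡⟨ regroup (binom (m ℕ.+ k) k) (binom m k) (binom (n ℕ.+ k) k) (binom n k) ⟦ k ⟧ (harm m n k) (pole x k) ⟩
  - ⟦ k ⟧ * (β m k * β n k) * (pole x k * pole x k) + β m k * β n k * (1ℚ + ⟦ k ⟧ * harm m n k) * pole x k
    ≡⟨ cong₂ (λ a b → a * (pole x k * pole x k) + b * pole x k) (doubleCoeff-≤ k≤n) (simpleCoeff-≤ k≤n) ⟨
  pfTerm (doubleCoeff m n) (simpleCoeff m n) x k ∎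
  where
  regroup : ∀ b₁ b₂ b₃ b₄ K h u → b₁ * b₂ * b₃ * b₄ * ((- K) * (u * u) + (1ℚ + K * h) * u)
                                   ≡ - K * (b₁ * b₂ * (b₃ * b₄)) * (u * u) + b₁ * b₂ * (b₃ * b₄) * (1ℚ + K * h) * u
  regroup b₁ b₂ b₃ b₄ K h u = solve (b₁ ∷ b₂ ∷ b₃ ∷ b₄ ∷ K ∷ h ∷ u ∷ []) ℚ-ring

second-sum-term : ∀ {m n k} x → n < k →
  sign (k ∸ n) * inv (x + ⟦ k ⟧) * binom (m ℕ.+ k) k * binom m k * binom (n ℕ.+ k) k * inv (binom (k ∸ 1) n)
  ≡ pfTerm (doubleCoeff m n) (simpleCoeff m n) x k
second-sum-term {m} {n} {k} x n<k = begin
  sign (k ∸ n) * pole x k * binom (m ℕ.+ k) k * binom m k * binom (n ℕ.+ k) k * inv (binom (k ∸ 1) n)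
    ≡⟨ regroup (sign (k ∸ n)) (pole x k) (binom (m ℕ.+ k) k) (binom m k) (binom (n ℕ.+ k) k) (inv (binom (k ∸ 1) n)) ⟩
  0ℚ * (pole x k * pole x k) + sign (k ∸ n) * β m k * binom (n ℕ.+ k) k * inv (binom (k ∸ 1) n) * pole x k
    ≡⟨ cong₂ (λ a b → a * (pole x k * pole x k) + b * pole x k) (doubleCoeff-> k≰n) (simpleCoeff-> k≰n) ⟨
  pfTerm (doubleCoeff m n) (simpleCoeff m n) x k ∎
  where
  k≰n = ℕ.<⇒≱ n<k
  regroup : ∀ σ u b₁ b₂ b₃ d → σ * u * b₁ * b₂ * b₃ * d ≡ 0ℚ * (u * u) + σ * (b₁ * b₂) * b₃ * d * u
  regroup σ u b₁ b₂ b₃ d = solve (σ ∷ u ∷ b₁ ∷ b₂ ∷ b₃ ∷ d ∷ []) ℚ-ring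

rising-side : ∀ {n m} x → n ≤ m → Regular m x →
  x * rising (1ℚ - x) n * rising (1ℚ - x) m * inv (rising x (suc n) * rising x (suc m)) ≡ x * R n x * R m x
rising-side {n} {m} x n≤m x-reg = begin
  x * rising (1ℚ - x) n * rising (1ℚ - x) m * inv (rising x (suc n) * rising x (suc m))
    ≡⟨ cong (x * rising (1ℚ - x) n * rising (1ℚ - x) m *_) (inv-distrib-* (rising≢0 n x-reg′) (rising≢0 m x-reg)) ⟩
  x * rising (1ℚ - x) n * rising (1ℚ - x) m * (inv (rising x (suc n)) * inv (rising x (suc m)))
    ≡⟨ interchange x (rising (1ℚ - x) n) (rising (1ℚ - x) m) (inv (rising x (suc n))) (inv (rising x (suc m))) ⟩
  x * (rising (1ℚ - x) n * inv (rising x (suc n))) * (rising (1ℚ - x) m * inv (rising x (suc m)))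
    ≡⟨ cong₂ (λ a b → x * a * b) (rising-quotient n x-reg′) (rising-quotient m x-reg) ⟩
  x * R n x * R m x ∎
  where
  x-reg′ : Regular n x
  x-reg′ = Regular-≤ {y = x} n≤m x-reg
  interchange : ∀ x a b c d → x * a * b * (c * d) ≡ x * (a * c) * (b * d)
  interchange x a b c d = solve (x ∷ a ∷ b ∷ c ∷ d ∷ []) ℚ-ring

theorem2p1 : (m n : ℕ) → 1 ≤ n → n ≤ m → (x : ℚ)
    → (∀ (j : ℕ) → j ≤ m → x + ⟦ j ⟧ ≢ 0ℚ)
    → sumFromTo 0 n (λ k → binom (m ℕ.+ k) k * binom m k * binom (n ℕ.+ k) k * binom n k
          * ((- ⟦ k ⟧) * inv ((x + ⟦ k ⟧) * (x + ⟦ k ⟧))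
             + (1ℚ + ⟦ k ⟧ * (H 1 (m ℕ.+ k) + H 1 (m ∸ k) + H 1 (n ℕ.+ k) + H 1 (n ∸ k) - ⟦ 4 ⟧ * H 1 k))
               * inv (x + ⟦ k ⟧)))
      + sumFromTo (suc n) m (λ k → sign (k ∸ n) * inv (x + ⟦ k ⟧)
          * binom (m ℕ.+ k) k * binom m k * binom (n ℕ.+ k) k * inv (binom (k ∸ 1) n))
      ≡ x * rising (1ℚ - x) n * rising (1ℚ - x) m * inv (rising x (suc n) * rising x (suc m))
theorem2p1 m n _ n≤m x x-reg = begin
  _                                                   ≡⟨ cong₂ _+_ (sumCount-cong 0 (suc n) first-sum)
                                                                   (sumCount-cong (suc n) (m ∸ n) second-sum) ⟩
  sumCount 0 (suc n) T + sumCount (suc n) (m ∸ n) T   ≡⟨ sumCount-split 0 (suc n) (m ∸ n) T ⟨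
  sumCount 0 (suc (n ℕ.+ (m ∸ n))) T                  ≡⟨ cong (λ c → sumCount 0 (suc c) T) (ℕ.m+[n∸m]≡n n≤m) ⟩
  expansion m n m x                                   ≡⟨ off-diagonal (ℕ.≤⇒≤′ n≤m) x x-reg ⟩
  x * R n x * R m x                                   ≡⟨ rising-side x n≤m x-reg ⟨
  _                                                   ∎
  where
  T = pfTerm (doubleCoeff m n) (simpleCoeff m n) x
  first-sum = λ k k<1+n → first-sum-term {m} {n} x (x-reg k (ℕ.≤-trans (ℕ.s≤s⁻¹ k<1+n) n≤m)) (ℕ.s≤s⁻¹ k<1+n)
  second-sum = λ i _ → second-sum-term {m} {n} x (s≤s (ℕ.m≤m+n n i))
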